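{- Let $T$ be a tree on $n\ge 2$ vertices with maximum degree $\Delta$. Then 1. $S(T)=\frac{4(n-2)}{n}+\frac{2(n-2)}{n}\sum_{i=3}^{\Delta}N_i(i-2)$; 2. $\mathrm{Var}(T)=\frac{2(n-2)}{n^2}+\frac1n\sum_{i=3}^{\Delta}N_i(i-1)(i-2)$; 3. $IRR(T)=\frac n2(\Delta-1)$; 4. $IRD(T)\le \dfrac{4N_\Delta(\Delta-1)+2N_\Delta\sum_{i=3}^{\Delta}(i-2)N_i(\Delta-1)}{2+(\Delta-1)N_\Delta}$, with equality if and only if the set of vertex degrees of $T$ is contained in $\{1,2,\Delta\}$.
   Context: $N_i$ denotes the number of vertices of degree $i$ (sums over $i$ from $3$ to $\Delta$ are empty if $\Delta<3$). For a graph with $n$ vertices, $m$ edges, degrees $d_1,\dots,d_n$, maximum degree $\Delta$, minimum degree $\delta$: $S(G)=\sum_i|d_i-\frac{2m}{n}|$, $\mathrm{Var}(G)=\frac1n\sum_i(d_i-\frac{2m}{n})^2$, $IRR(G)=\frac n2(\Delta-\delta)$, $IRD(G)=\frac{2N_\Delta N_\delta}{N_\delta+N_\Delta}(\Delta-\delta)$ (for a tree, $\delta=1$). -}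

module Defs where

open import Data.Bool using (Bool; true; false; T; _∧_; if_then_else_)
open import Data.Nat as ℕ using (ℕ; zero; suc; _≤_; _⊔_; _⊓_; _<ᵇ_; _≡ᵇ_)
open import Data.Fin using (Fin; toℕ)
open import Data.Nat.ListAction using (sum)
open import Data.List using (List; []; _∷_; _++_; length; map; foldr; filterᵇ; allFin; upTo; last)
open import Data.List.Relation.Unary.Linked using (Linked)
open import Data.List.Relation.Unary.Unique.Propositional using (Unique)
open import Data.Integer using (+_)
open import Data.Rational using (ℚ; 0ℚ; _/_; _+_; _*_; _-_; ∣_∣)
open import Data.Maybe using (just)
open import Data.Product using (Σ; _×_; ∃)
open import Relation.Binary.PropositionalEquality using (_≡_)
open import Relation.Nullary using (¬_)

record Graph (n : ℕ) : Set where
  field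
    adj    : Fin n → Fin n → Bool
    sym    : ∀ u v → adj u v ≡ adj v u
    irrefl : ∀ v → adj v v ≡ false
open Graph public

Adj : ∀ {n} → Graph n → Fin n → Fin n → Set
Adj G u v = T (adj G u v)

Walk : ∀ {n} → Graph n → Fin n → Fin n → Set
Walk G u v = Σ (List _) λ ws → Linked (Adj G) (u ∷ ws) × last (u ∷ ws) ≡ just v

Connected : ∀ {n} → Graph n → Set
Connected G = ∀ u v → Walk G u v

HasCycle : ∀ {n} → Graph n → Set
HasCycle G = Σ _ λ u → Σ (List _) λ ws →
  (2 ≤ length ws) × Unique (u ∷ ws) × Linked (Adj G) (u ∷ ws ++ u ∷ [])

IsTree : ∀ {n} → Graph n → Set
IsTree G = Connected G × ¬ HasCycle G

degree : ∀ {n} → Graph n → Fin n → ℕ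
degree {n} G v = length (filterᵇ (adj G v) (allFin n))

-- number of edges: unordered pairs {u,v}, counted as u < v
edges : ∀ {n} → Graph n → ℕ
edges {n} G = sum (map (λ u → length (filterᵇ (λ v → (toℕ u <ᵇ toℕ v) ∧ adj G u v) (allFin n))) (allFin n))

N : ∀ {n} → Graph n → ℕ → ℕ
N {n} G i = length (filterᵇ (λ v → degree G v ≡ᵇ i) (allFin n))

maxDeg : ∀ {n} → Graph n → ℕ
maxDeg {n} G = foldr _⊔_ 0 (map (degree G) (allFin n))

-- minimum degree (every degree is < n, so starting the fold at n gives the
-- true minimum whenever n ≥ 1)
minDeg : ∀ {n} → Graph n → ℕ
minDeg {n} G = foldr _⊓_ n (map (degree G) (allFin n))

ℕ→ℚ : ℕ → ℚ
ℕ→ℚ k = + k / 1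

-- division of a rational by a natural number (convention: p / 0 = 0)
divℕ : ℚ → ℕ → ℚ
divℕ p zero    = 0ℚ
divℕ p (suc d) = p * (+ 1 / suc d)

sumℚ : List ℚ → ℚ
sumℚ = foldr _+_ 0ℚ

-- Σ_{i=3}^{Δ} f i   (empty if Δ < 3)
sum3to : ℕ → (ℕ → ℚ) → ℚ
sum3to Δ f = sumℚ (map (λ k → f (3 ℕ.+ k)) (upTo (Δ ℕ.∸ 2)))

avgDeg : ∀ {n} → Graph n → ℚ
avgDeg {n} G = divℕ (ℕ→ℚ (2 ℕ.* edges G)) n

S : ∀ {n} → Graph n → ℚ
S {n} G = sumℚ (map (λ v → ∣ ℕ→ℚ (degree G v) - avgDeg G ∣) (allFin n))

Var : ∀ {n} → Graph n → ℚ
Var {n} G = divℕ (sumℚ (map (λ v → (ℕ→ℚ (degree G v) - avgDeg G) * (ℕ→ℚ (degree G v) - avgDeg G)) (allFin n))) n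

IRR : ∀ {n} → Graph n → ℚ
IRR {n} G = divℕ (ℕ→ℚ n) 2 * (ℕ→ℚ (maxDeg G) - ℕ→ℚ (minDeg G))

IRD : ∀ {n} → Graph n → ℚ
IRD G = divℕ (ℕ→ℚ (2 ℕ.* N G (maxDeg G) ℕ.* N G (minDeg G))) (N G (minDeg G) ℕ.+ N G (maxDeg G))
        * (ℕ→ℚ (maxDeg G) - ℕ→ℚ (minDeg G))

{-# OPTIONS --safe #-}
-- A tree on n ≥ 2 vertices has a leaf, and deleting it leaves a tree; hence all degrees are
-- at least 1, some degree is 1, and the degrees sum to 2(n − 1).  For the excess
-- P = Σ_v (d_v − 2)⁺ = Σ_{i≥3} (i − 2) N_i the degree sum gives N_1 = 2 + P.  The average
-- degree is 2(n − 1)/n, so n |d − 2(n − 1)/n| is n − 2 at a leaf and n (d − 2) + 2 elsewhere;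
-- summing these values (and their squares) over the vertices and eliminating N_1 yields S and
-- Var.  IRR only needs δ = 1.  With δ = 1, IRD and the claimed bound are X / (2 + P + N_Δ) and
-- X / (2 + (Δ − 1) N_Δ) for the same X = 2 N_Δ (2 + P) (Δ − 1), and P ≥ (Δ − 2) N_Δ with
-- equality exactly when every degree is 1, 2 or Δ.
module Submission where

open import Defs hiding (sym)
open import Data.Nat using (ℕ; _≤_)
open import Data.Nat as ℕ using ()
open import Data.Rational using (ℚ; _+_; _*_; _-_) renaming (_≤_ to _≤ℚ_)
open import Data.Product using (_×_)
open import Data.Sum using (_⊎_)
open import Function.Bundles using (_⇔_)
open import Relation.Binary.PropositionalEquality using (_≡_)

open import Algebra.Bundles using (Ring)
open import Data.Bool using (Bool; true; false; T; _∧_; not)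
open import Data.Bool.Properties using (T-∧; T-≡)
open import Data.Empty using (⊥; ⊥-elim)
open import Data.Fin as Fin using (Fin)
import Data.Fin.Properties as FinP
import Data.Integer as ℤ
import Data.Integer.Properties as ℤP
open import Data.List using (List; []; _∷_; _++_; length; lookup; map; tabulate; foldr; filterᵇ; last; applyUpTo)
open import Data.Maybe using (just)
open import Data.List.Membership.Propositional.Properties using (∈-lookup; ∈-∃++)
open import Data.List.Properties using (map-tabulate)
open import Data.List.Relation.Unary.All using ([]; _∷_)
import Data.List.Relation.Unary.All as All
import Data.List.Relation.Unary.All.Properties as AllP
open import Data.List.Relation.Unary.AllPairs using ([]; _∷_)
open import Data.List.Relation.Unary.Linked using (Linked; []; [-]; _∷_)
open import Data.List.Relation.Unary.Unique.Propositional using (Unique)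
open import Data.Nat using (zero; suc; _<_; z≤n; s≤s; _≡ᵇ_; _<ᵇ_; _⊔_; _⊓_; _∸_) renaming (∣_-_∣ to ∣_-_∣ₙ)
import Data.Nat.Coprimality as Coprime
open import Data.Nat.ListAction renaming (sum to sumₗ)
import Data.Nat.Properties as ℕP
open import Data.Nat.Tactic.RingSolver using (solve-∀)
open import Data.Product using (∃; _,_; proj₁; proj₂)
open import Data.Rational as ℚ using (-_; ∣_∣; 0ℚ; 1ℚ; mkℚ; _/_)
import Data.Rational.Properties as ℚP
open import Data.Rational.Solver using (module +-*-Solver)
open +-*-Solver using (solve; _:+_; _:*_; :-_; _:-_; _:=_; con)
open import Data.Sum using (inj₁; inj₂)
open import Function using (_∘_; id)
open import Function.Bundles using (Equivalence; mk⇔)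
open import Function.Definitions using (Injective)
open import Relation.Binary using (tri<; tri≈; tri>)
open import Relation.Binary.PropositionalEquality using (_≢_; refl; sym; trans; cong; cong₂; subst; subst₂; module ≡-Reasoning)
open import Relation.Nullary using (¬_; Dec; yes; no; does)
open import Relation.Nullary.Decidable using (T?; _×-dec_; ¬?)
open import Algebra.Properties.Semiring.Sum ℕP.+-*-semiring
  using (sum; sum-syntax; sum-cong-≗; ∑-distrib-+; ∑-comm; *-distribˡ-sum; *-distribʳ-sum)
import Algebra.Properties.Semiring.Sum (Ring.semiring ℚP.+-*-ring) as ℚΣ

[_] : Bool → ℕ
[ true ]  = 1
[ false ] = 0

T⇒[]≡1 : ∀ {b} → T b → [ b ] ≡ 1
T⇒[]≡1 {true} _ = refl

T⇒≡true : ∀ {b} → T b → b ≡ true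
T⇒≡true = Equivalence.to T-≡

¬T⇒≡false : ∀ {b} → ¬ T b → b ≡ false
¬T⇒≡false {false} _  = refl
¬T⇒≡false {true}  ¬t = ⊥-elim (¬t _)

∧-intro : ∀ {a b} → T a → T b → T (a ∧ b)
∧-intro ta tb = Equivalence.from T-∧ (ta , tb)

∧-elim : ∀ {a b} → T (a ∧ b) → T a × T b
∧-elim = Equivalence.to T-∧

_=ᵇ_ : ∀ {n} → Fin n → Fin n → Bool
i =ᵇ j = does (i Fin.≟ j)

=ᵇ⇒≡ : ∀ {n} {i j : Fin n} → T (i =ᵇ j) → i ≡ j
=ᵇ⇒≡ {i = i} {j} i=j with i Fin.≟ j
... | yes i≡j = i≡j

count : ∀ {n} → (Fin n → Bool) → ℕ
count p = sum (λ i → [ p i ])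

sum-mono-≤ : ∀ {n} {f g : Fin n → ℕ} → (∀ i → f i ≤ g i) → sum f ≤ sum g
sum-mono-≤ {zero}  f≤g = z≤n
sum-mono-≤ {suc n} f≤g = ℕP.+-mono-≤ (f≤g Fin.zero) (sum-mono-≤ (f≤g ∘ Fin.suc))

term≤sum : ∀ {n} (f : Fin n → ℕ) i → f i ≤ sum f
term≤sum f Fin.zero    = ℕP.m≤m+n _ _
term≤sum f (Fin.suc i) = ℕP.≤-trans (term≤sum (f ∘ Fin.suc) i) (ℕP.m≤n+m _ _)

sum-mono-≤-tight : ∀ {n} {f g : Fin n → ℕ} → (∀ i → f i ≤ g i) → sum g ≤ sum f → ∀ i → f i ≡ g i
sum-mono-≤-tight {f = f} {g} f≤g g≤f Fin.zero = ℕP.≤-antisym (f≤g Fin.zero)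
  (ℕP.+-cancelʳ-≤ _ _ _ (ℕP.≤-trans g≤f (ℕP.+-monoʳ-≤ (f Fin.zero) (sum-mono-≤ (f≤g ∘ Fin.suc)))))
sum-mono-≤-tight {f = f} {g} f≤g g≤f (Fin.suc i) = sum-mono-≤-tight (f≤g ∘ Fin.suc)
  (ℕP.+-cancelˡ-≤ (g Fin.zero) _ _ (ℕP.≤-trans g≤f (ℕP.+-monoˡ-≤ _ (f≤g Fin.zero)))) i

sum-zeros : ∀ n → ∑[ i < n ] 0 ≡ 0
sum-zeros zero    = refl
sum-zeros (suc n) = sum-zeros n

sum-ones : ∀ n → ∑[ i < n ] 1 ≡ n
sum-ones zero    = refl
sum-ones (suc n) = cong suc (sum-ones n)

sum-δ : ∀ {n} (l : Fin n) (c : Fin n → ℕ) → ∑[ i < n ] ([ i =ᵇ l ] ℕ.* c i) ≡ c l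
sum-δ {suc n} Fin.zero    c = trans (cong (ℕ._+ _) (ℕP.+-identityʳ (c Fin.zero)))
  (trans (cong (c Fin.zero ℕ.+_) (sum-zeros n)) (ℕP.+-identityʳ (c Fin.zero)))
sum-δ {suc n} (Fin.suc l) c = sum-δ l (c ∘ Fin.suc)

∑-δℕ : ∀ {r} (g : ℕ → ℕ) e → e < r → ∑[ k < r ] ([ e ≡ᵇ Fin.toℕ k ] ℕ.* g (Fin.toℕ k)) ≡ g e
∑-δℕ {suc r} g zero    _       = trans (cong₂ ℕ._+_ (ℕP.+-identityʳ (g 0)) (sum-zeros r)) (ℕP.+-identityʳ (g 0))
∑-δℕ {suc r} g (suc e) (s≤s e<r) = ∑-δℕ (g ∘ suc) e e<r

∑-+-* : ∀ {n} (f g : Fin n → ℕ) a → ∑[ v < n ] (f v ℕ.+ a ℕ.* g v) ≡ sum f ℕ.+ a ℕ.* sum g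
∑-+-* f g a = trans (∑-distrib-+ f (λ v → a ℕ.* g v)) (cong (sum f ℕ.+_) (sym (*-distribˡ-sum a g)))

∑-*-+ : ∀ {n} a (f g : Fin n → ℕ) → ∑[ v < n ] (a ℕ.* f v ℕ.+ g v) ≡ a ℕ.* sum f ℕ.+ sum g
∑-*-+ a f g = trans (∑-distrib-+ (λ v → a ℕ.* f v) g) (cong (ℕ._+ sum g) (sym (*-distribˡ-sum a f)))

∑-*-+-* : ∀ {n} a (f : Fin n → ℕ) b g → ∑[ v < n ] (a ℕ.* f v ℕ.+ b ℕ.* g v) ≡ a ℕ.* sum f ℕ.+ b ℕ.* sum g
∑-*-+-* a f b g = trans (∑-*-+ a f (λ v → b ℕ.* g v)) (cong (a ℕ.* sum f ℕ.+_) (sym (*-distribˡ-sum b g)))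

count-δ : ∀ {n} (l : Fin n) → count (_=ᵇ l) ≡ 1
count-δ l = trans (sum-cong-≗ (λ i → sym (ℕP.*-identityʳ [ i =ᵇ l ]))) (sum-δ l (λ _ → 1))

count>0⇒∃ : ∀ {n} (p : Fin n → Bool) → 0 < count p → ∃ λ i → T (p i)
count>0⇒∃ {suc n} p pos with p Fin.zero in eq
... | true  = Fin.zero , subst T (sym eq) _
... | false with count>0⇒∃ (p ∘ Fin.suc) pos
...   | i , pi = Fin.suc i , pi

count≤1⇒¬both : ∀ {n} (p : Fin (suc n) → Bool) → count p ≤ 1 → ∀ {j} → T (p Fin.zero) → ¬ T (p (Fin.suc j))
count≤1⇒¬both p c≤1 {j} p0 pj = ℕP.≤⇒≯ c≤1 (ℕP.+-mono-≤ (ℕP.≤-reflexive (sym (T⇒[]≡1 p0)))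
  (ℕP.≤-trans (ℕP.≤-reflexive (sym (T⇒[]≡1 pj))) (term≤sum (λ i → [ p (Fin.suc i) ]) j)))

count≤1⇒unique : ∀ {n} (p : Fin n → Bool) → count p ≤ 1 → ∀ {i j} → T (p i) → T (p j) → i ≡ j
count≤1⇒unique p c≤1 {Fin.zero}  {Fin.zero}  _  _  = refl
count≤1⇒unique p c≤1 {Fin.zero}  {Fin.suc j} pi pj = ⊥-elim (count≤1⇒¬both p c≤1 pi pj)
count≤1⇒unique p c≤1 {Fin.suc i} {Fin.zero}  pi pj = ⊥-elim (count≤1⇒¬both p c≤1 pj pi)
count≤1⇒unique p c≤1 {Fin.suc i} {Fin.suc j} pi pj = cong Fin.suc
  (count≤1⇒unique (p ∘ Fin.suc) (ℕP.≤-trans (ℕP.m≤n+m _ [ p Fin.zero ]) c≤1) pi pj)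

2≤count⇒∃≢ : ∀ {n} (p : Fin n → Bool) → 2 ≤ count p → ∀ j → ∃ λ i → T (p i) × i ≢ j
2≤count⇒∃≢ p two≤ j with FinP.any? (λ i → T? (p i) ×-dec ¬? (i Fin.≟ j))
... | yes found = found
... | no none = ⊥-elim (ℕP.≤⇒≯ (ℕP.≤-trans (sum-mono-≤ p⊆j) (ℕP.≤-reflexive (count-δ j))) two≤)
  where
  p⊆j : ∀ i → [ p i ] ≤ [ i =ᵇ j ]
  p⊆j i with p i in eq | i Fin.≟ j
  ... | false | _       = z≤n
  ... | true  | yes _   = ℕP.≤-refl
  ... | true  | no i≢j = ⊥-elim (none (i , subst T (sym eq) _ , i≢j))

lookup-injective : ∀ {A : Set} {xs : List A} → Unique xs → Injective _≡_ _≡_ (lookup xs)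
lookup-injective (x∉ ∷ u) {Fin.zero}  {Fin.zero}  _  = refl
lookup-injective (x∉ ∷ u) {Fin.zero}  {Fin.suc j} eq = ⊥-elim (All.lookup x∉ (∈-lookup j) eq)
lookup-injective (x∉ ∷ u) {Fin.suc i} {Fin.zero}  eq = ⊥-elim (All.lookup x∉ (∈-lookup i) (sym eq))
lookup-injective (x∉ ∷ u) {Fin.suc i} {Fin.suc j} eq = cong Fin.suc (lookup-injective u eq)

unique⇒length≤ : ∀ {n} {xs : List (Fin n)} → Unique xs → length xs ≤ n
unique⇒length≤ u = FinP.injective⇒≤ (lookup-injective u)

unique-++⇒unique-∷ : ∀ {A : Set} (xs : List A) {y ys} → Unique (xs ++ y ∷ ys) → Unique (y ∷ xs)
unique-++⇒unique-∷ []       _         = [] ∷ []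
unique-++⇒unique-∷ (x ∷ xs) (x∉ ∷ u) with unique-++⇒unique-∷ xs u
... | y∉xs ∷ uxs = ((λ y≡x → All.head (AllP.++⁻ʳ xs x∉) (sym y≡x)) ∷ y∉xs) ∷ AllP.++⁻ˡ xs x∉ ∷ uxs

linked-++⁻ˡ : ∀ {A : Set} {R : A → A → Set} (xs : List A) {y ys} → Linked R (xs ++ y ∷ ys) → Linked R (xs ++ y ∷ [])
linked-++⁻ˡ []                _        = [-]
linked-++⁻ˡ (x ∷ [])          (r ∷ _)  = r ∷ [-]
linked-++⁻ˡ (x ∷ x′ ∷ xs)     (r ∷ rs) = r ∷ linked-++⁻ˡ (x′ ∷ xs) rs

-- Leaves of acyclic graphs

_∖_ : ∀ {n} → (Fin n → Bool) → Fin n → Fin n → Bool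
(A ∖ l) v = not (v =ᵇ l) ∧ A v

∖-intro : ∀ {n} {A : Fin n → Bool} {l v} → T (A v) → v ≢ l → T ((A ∖ l) v)
∖-intro {l = l} {v} v∈A v≢l with v Fin.≟ l
... | yes v≡l = ⊥-elim (v≢l v≡l)
... | no _    = v∈A

∖-elim : ∀ {n} {A : Fin n → Bool} {l v} → T ((A ∖ l) v) → T (A v) × v ≢ l
∖-elim {l = l} {v} v∈A∖l with v Fin.≟ l
... | no v≢l = v∈A∖l , v≢l

count-∖ : ∀ {n} (A : Fin n → Bool) {l} → T (A l) → count A ≡ suc (count (A ∖ l))
count-∖ {n} A {l} l∈A = begin
  count A                                         ≡⟨ sum-cong-≗ split ⟩
  ∑[ v < n ] ([ (A ∖ l) v ] ℕ.+ [ v =ᵇ l ] ℕ.* 1)  ≡⟨ ∑-distrib-+ (λ v → [ (A ∖ l) v ]) (λ v → [ v =ᵇ l ] ℕ.* 1) ⟩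
  count (A ∖ l) ℕ.+ ∑[ v < n ] ([ v =ᵇ l ] ℕ.* 1)  ≡⟨ cong (count (A ∖ l) ℕ.+_) (sum-δ l (λ _ → 1)) ⟩
  count (A ∖ l) ℕ.+ 1                              ≡⟨ ℕP.+-comm _ 1 ⟩
  suc (count (A ∖ l))                              ∎
  where
  open ≡-Reasoning
  split : ∀ v → [ A v ] ≡ [ (A ∖ l) v ] ℕ.+ [ v =ᵇ l ] ℕ.* 1
  split v with v Fin.≟ l
  ... | yes refl rewrite T⇒≡true l∈A = refl
  ... | no _     = sym (ℕP.+-identityʳ _)

-- For an arc v → u of A (a = A v, b = A u, e = adj v u) and a vertex l of A (p = v is l,
-- q = u is l): the arc avoids l, leaves l, or enters l, and not both since there are no loops.
split-arc : ∀ a b p q e → (T p → T a) → (T q → T b) → (T p → T q → ¬ T e) →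
  [ a ∧ (b ∧ e) ] ≡ [ (not p ∧ a) ∧ ((not q ∧ b) ∧ e) ] ℕ.+ [ p ] ℕ.* [ b ∧ e ] ℕ.+ [ q ] ℕ.* [ a ∧ e ]
split-arc a     b     false false e _  _  _  = sym (trans (ℕP.+-identityʳ _) (ℕP.+-identityʳ _))
split-arc false b     true  q     e pa _  _  = ⊥-elim (pa _)
split-arc a     false p     true  e _  qb _  = ⊥-elim (qb _)
split-arc true  b     true  false e _  _  _  = sym (trans (ℕP.+-identityʳ _) (ℕP.+-identityʳ _))
split-arc false true  false true  e _  _  _  = refl
split-arc true  true  false true  e _  _  _  = sym (ℕP.+-identityʳ _)
split-arc true  true  true  true  false _ _ _ = refl
split-arc true  true  true  true  true  _ _ ¬e = ⊥-elim (¬e _ _ _)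

module _ {n : ℕ} (G : Graph n) where

  adj-sym : ∀ {u v} → Adj G u v → Adj G v u
  adj-sym {u} {v} = subst T (Graph.sym G u v)

  adj-irrefl : ∀ {u} → ¬ Adj G u u
  adj-irrefl {u} = subst T (Graph.irrefl G u)

  degIn : (Fin n → Bool) → Fin n → ℕ
  degIn A v = count (λ u → A u ∧ adj G v u)

  arcsIn : (Fin n → Bool) → ℕ
  arcsIn A = ∑[ v < n ] ∑[ u < n ] [ A v ∧ (A u ∧ adj G v u) ]

  data WalkIn (A : Fin n → Bool) : Fin n → Fin n → Set where
    here : ∀ {u} → T (A u) → WalkIn A u u
    step : ∀ {u x v} → T (A u) → Adj G u x → WalkIn A x v → WalkIn A u v

  walkIn-head : ∀ {A u v} → WalkIn A u v → T (A u)
  walkIn-head (here u∈A)     = u∈A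
  walkIn-head (step u∈A _ _) = u∈A

  ConnectedIn : (Fin n → Bool) → Set
  ConnectedIn A = ∀ {u v} → T (A u) → T (A v) → WalkIn A u v

  degIn≥1 : ∀ A → ConnectedIn A → 2 ≤ count A → ∀ {v} → T (A v) → 1 ≤ degIn A v
  degIn≥1 A conn two≤ {v} v∈A with 2≤count⇒∃≢ A two≤ v
  ... | u , u∈A , u≢v with conn v∈A u∈A
  ...   | here _ = ⊥-elim (u≢v refl)
  ...   | step {x = x} _ v~x walk =
    ℕP.≤-trans (ℕP.≤-reflexive (sym (T⇒[]≡1 (∧-intro (walkIn-head walk) v~x)))) (term≤sum _ x)

  module _ (acyclic : ¬ HasCycle G) (A : Fin n → Bool) (degIn≥2 : ∀ {v} → T (A v) → 2 ≤ degIn A v) where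
    open import Data.List.Membership.DecPropositional (FinP._≟_ {n}) using (_∈?_)

    -- The newest vertex c of the path c, q, … has a neighbour y ≠ q in A: if y is new the
    -- path grows, which cannot happen more than n times, and otherwise it closes a cycle.
    ¬path : (fuel : ℕ) {c q : Fin n} (rest : List (Fin n)) → T (A c) →
            Unique (c ∷ q ∷ rest) → Linked (Adj G) (c ∷ q ∷ rest) → n < fuel ℕ.+ length (c ∷ q ∷ rest) → ⊥
    ¬path zero    rest c∈A unique linked n< = ℕP.<⇒≱ n< (unique⇒length≤ unique)
    ¬path (suc fuel) {c} {q} rest c∈A unique linked n<
      with 2≤count⇒∃≢ (λ y → A y ∧ adj G c y) (degIn≥2 c∈A) q
    ... | y , y∈A∧c~y , y≢q with ∧-elim y∈A∧c~y | y ∈? rest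
    ...   | y∈A , c~y | no y∉rest =
      ¬path fuel (q ∷ rest) y∈A ((y≢c ∷ y≢q ∷ AllP.¬Any⇒All¬ rest y∉rest) ∷ unique)
        (adj-sym c~y ∷ linked) (subst (n <_) (sym (ℕP.+-suc fuel _)) n<)
      where
      y≢c : y ≢ c
      y≢c refl = adj-irrefl c~y
    ...   | y∈A , c~y | yes y∈rest with ∈-∃++ y∈rest
    ...     | pre , post , refl = acyclic (y , c ∷ q ∷ pre , s≤s (s≤s z≤n) ,
      unique-++⇒unique-∷ (c ∷ q ∷ pre) unique , adj-sym c~y ∷ linked-++⁻ˡ (c ∷ q ∷ pre) linked)

    acyclic⇒¬minDegIn≥2 : 0 < count A → ⊥
    acyclic⇒¬minDegIn≥2 A≠∅ with count>0⇒∃ A A≠∅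
    ... | v , v∈A with 2≤count⇒∃≢ (λ x → A x ∧ adj G v x) (degIn≥2 v∈A) v
    ...   | x , x∈A∧v~x , x≢v = ¬path n [] (proj₁ (∧-elim x∈A∧v~x)) ((x≢v ∷ []) ∷ [] ∷ [])
      (adj-sym (proj₂ (∧-elim x∈A∧v~x)) ∷ [-]) (ℕP.m<m+n n (s≤s z≤n))

  ∃leaf : ¬ HasCycle G → ∀ A → ConnectedIn A → 2 ≤ count A → ∃ λ l → T (A l) × degIn A l ≡ 1
  ∃leaf acyclic A conn two≤ with FinP.any? (λ v → T? (A v) ×-dec (degIn A v ℕ.<? 2))
  ... | yes (l , l∈A , deg<2) = l , l∈A , ℕP.≤-antisym (ℕP.≤-pred deg<2) (degIn≥1 A conn two≤ l∈A)
  ... | no ¬leaf = ⊥-elim (acyclic⇒¬minDegIn≥2 acyclic A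
          (λ {v} v∈A → ℕP.≮⇒≥ (λ deg<2 → ¬leaf (v , v∈A , deg<2))) (ℕP.<-≤-trans (s≤s z≤n) two≤))

  module _ (A : Fin n → Bool) {l : Fin n} (leaf : degIn A l ≡ 1) where

    leaf-neighbour-unique : ∀ {a b} → T (A a) → Adj G l a → T (A b) → Adj G l b → a ≡ b
    leaf-neighbour-unique a∈A l~a b∈A l~b =
      count≤1⇒unique (λ u → A u ∧ adj G l u) (ℕP.≤-reflexive leaf) (∧-intro a∈A l~a) (∧-intro b∈A l~b)

    -- A walk between vertices other than the leaf l can only enter l to come straight back.
    walkIn-∖ : ∀ {u v} → WalkIn A u v → u ≢ l → v ≢ l → WalkIn (A ∖ l) u v
    walkIn-∖ (here u∈A) u≢l _ = here (∖-intro {A = A} u∈A u≢l)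
    walkIn-∖ {u} (step {x = x} u∈A u~x walk) u≢l v≢l with x Fin.≟ l
    ... | no x≢l = step (∖-intro {A = A} u∈A u≢l) u~x (walkIn-∖ walk x≢l v≢l)
    ... | yes refl with walk
    ...   | here _ = ⊥-elim (v≢l refl)
    ...   | step {x = y} _ l~y walk′ with leaf-neighbour-unique (walkIn-head walk′) l~y u∈A (adj-sym u~x)
    ...     | refl = walkIn-∖ walk′ u≢l v≢l

    arcsIn-∖ : T (A l) → arcsIn A ≡ 2 ℕ.+ arcsIn (A ∖ l)
    arcsIn-∖ l∈A = begin
      arcsIn A
        ≡⟨ sum-cong-≗ (λ v → sum-cong-≗ (λ u → split-arc (A v) (A u) (v =ᵇ l) (u =ᵇ l) (adj G v u)
             (at-l {v}) (at-l {u}) (λ v=l u=l v~u → adj-irrefl (subst₂ (Adj G) (=ᵇ⇒≡ v=l) (=ᵇ⇒≡ u=l) v~u)))) ⟩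
      ∑[ v < n ] ∑[ u < n ] (arc∖ v u ℕ.+ out v u ℕ.+ into v u)
        ≡⟨ sum-cong-≗ (λ v → trans (∑-distrib-+ (λ u → arc∖ v u ℕ.+ out v u) (into v))
                               (cong (ℕ._+ sum (into v)) (∑-distrib-+ (arc∖ v) (out v)))) ⟩
      ∑[ v < n ] (sum (arc∖ v) ℕ.+ sum (out v) ℕ.+ sum (into v))
        ≡⟨ trans (∑-distrib-+ (λ v → sum (arc∖ v) ℕ.+ sum (out v)) (λ v → sum (into v)))
                 (cong (ℕ._+ ∑[ v < n ] sum (into v)) (∑-distrib-+ (λ v → sum (arc∖ v)) (λ v → sum (out v)))) ⟩
      arcsIn (A ∖ l) ℕ.+ ∑[ v < n ] sum (out v) ℕ.+ ∑[ v < n ] sum (into v)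
        ≡⟨ cong₂ (λ a b → arcsIn (A ∖ l) ℕ.+ a ℕ.+ b) arcs-out arcs-into ⟩
      arcsIn (A ∖ l) ℕ.+ 1 ℕ.+ 1
        ≡⟨ ℕP.+-comm (arcsIn (A ∖ l) ℕ.+ 1) 1 ⟩
      suc (arcsIn (A ∖ l) ℕ.+ 1)
        ≡⟨ cong suc (ℕP.+-comm (arcsIn (A ∖ l)) 1) ⟩
      2 ℕ.+ arcsIn (A ∖ l) ∎
      where
      open ≡-Reasoning
      arc∖ out into : Fin n → Fin n → ℕ
      arc∖ v u = [ (A ∖ l) v ∧ ((A ∖ l) u ∧ adj G v u) ]
      out  v u = [ v =ᵇ l ] ℕ.* [ A u ∧ adj G v u ]
      into v u = [ u =ᵇ l ] ℕ.* [ A v ∧ adj G v u ]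
      at-l : ∀ {v} → T (v =ᵇ l) → T (A v)
      at-l v=l = subst (T ∘ A) (sym (=ᵇ⇒≡ v=l)) l∈A
      arcs-out : ∑[ v < n ] sum (out v) ≡ 1
      arcs-out = trans (sum-cong-≗ (λ v → sym (*-distribˡ-sum [ v =ᵇ l ] (λ u → [ A u ∧ adj G v u ]))))
                       (trans (sum-δ l (degIn A)) leaf)
      arcs-into : ∑[ v < n ] sum (into v) ≡ 1
      arcs-into = trans (sum-cong-≗ (λ v → trans (sum-δ l (λ u → [ A v ∧ adj G v u ]))
                                                  (cong (λ b → [ A v ∧ b ]) (Graph.sym G v l))))
                        leaf

  arcsIn-tree : ¬ HasCycle G → ∀ k A → count A ≡ suc k → ConnectedIn A → arcsIn A ≡ k ℕ.+ k
  arcsIn-tree acyclic zero A |A|≡1 conn =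
    trans (sum-cong-≗ (λ v → trans (sum-cong-≗ (no-arc v)) (sum-zeros n))) (sum-zeros n)
    where
    no-arc : ∀ v u → [ A v ∧ (A u ∧ adj G v u) ] ≡ 0
    no-arc v u with A v in v∈A | A u in u∈A
    ... | false | _     = refl
    ... | true  | false = refl
    ... | true  | true with count≤1⇒unique A (ℕP.≤-reflexive |A|≡1) (subst T (sym v∈A) _) (subst T (sym u∈A) _)
    ...   | refl rewrite Graph.irrefl G v = refl
  arcsIn-tree acyclic (suc k) A |A|≡2+k conn with ∃leaf acyclic A conn (subst (2 ≤_) (sym |A|≡2+k) (s≤s (s≤s z≤n)))
  ... | l , l∈A , leaf = begin
    arcsIn A                    ≡⟨ arcsIn-∖ A leaf l∈A ⟩
    2 ℕ.+ arcsIn (A ∖ l)        ≡⟨ cong (2 ℕ.+_) (arcsIn-tree acyclic k (A ∖ l) |A∖l| conn∖) ⟩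
    2 ℕ.+ (k ℕ.+ k)             ≡⟨ cong suc (sym (ℕP.+-suc k k)) ⟩
    suc k ℕ.+ suc k             ∎
    where
    open ≡-Reasoning
    |A∖l| : count (A ∖ l) ≡ suc k
    |A∖l| = ℕP.suc-injective (trans (sym (count-∖ A l∈A)) |A|≡2+k)
    conn∖ : ConnectedIn (A ∖ l)
    conn∖ u∈A∖l v∈A∖l with ∖-elim {A = A} u∈A∖l | ∖-elim {A = A} v∈A∖l
    ... | u∈A , u≢l | v∈A , v≢l = walkIn-∖ A leaf (conn u∈A v∈A) u≢l v≢l

length-filterᵇ-tabulate : ∀ {A : Set} {n} (p : A → Bool) (g : Fin n → A) →
                          length (filterᵇ p (tabulate g)) ≡ count (p ∘ g)
length-filterᵇ-tabulate {n = zero}  p g = refl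
length-filterᵇ-tabulate {n = suc n} p g with p (g Fin.zero)
... | true  = cong suc (length-filterᵇ-tabulate p (g ∘ Fin.suc))
... | false = length-filterᵇ-tabulate p (g ∘ Fin.suc)

sumₗ-tabulate : ∀ {n} (f : Fin n → ℕ) → sumₗ (tabulate f) ≡ sum f
sumₗ-tabulate {zero}  f = refl
sumₗ-tabulate {suc n} f = cong (f Fin.zero ℕ.+_) (sumₗ-tabulate (f ∘ Fin.suc))

≤-foldr-⊔ : ∀ {n} (f : Fin n → ℕ) i → f i ≤ foldr _⊔_ 0 (tabulate f)
≤-foldr-⊔ f Fin.zero    = ℕP.m≤m⊔n _ _
≤-foldr-⊔ f (Fin.suc i) = ℕP.m≤n⇒m≤o⊔n (f Fin.zero) (≤-foldr-⊔ (f ∘ Fin.suc) i)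

foldr-⊔-attained : ∀ {n} (f : Fin (suc n) → ℕ) → ∃ λ i → f i ≡ foldr _⊔_ 0 (tabulate f)
foldr-⊔-attained {zero}  f = Fin.zero , sym (ℕP.⊔-identityʳ (f Fin.zero))
foldr-⊔-attained {suc n} f with ℕP.⊔-sel (f Fin.zero) (foldr _⊔_ 0 (tabulate (f ∘ Fin.suc)))
... | inj₁ f₀≡max = Fin.zero , sym f₀≡max
... | inj₂ rest≡max with foldr-⊔-attained (f ∘ Fin.suc)
...   | i , fᵢ≡rest = Fin.suc i , trans fᵢ≡rest (sym rest≡max)

foldr-⊓≡1 : ∀ {n} b (f : Fin n → ℕ) → 1 ≤ b → (∀ i → 1 ≤ f i) → ∀ j → f j ≡ 1 → foldr _⊓_ b (tabulate f) ≡ 1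
foldr-⊓≡1 b f 1≤b 1≤f j fⱼ≡1 = ℕP.≤-antisym (≤1 j fⱼ≡1) (≥1 f 1≤f)
  where
  ≥1 : ∀ {n} (f : Fin n → ℕ) → (∀ i → 1 ≤ f i) → 1 ≤ foldr _⊓_ b (tabulate f)
  ≥1 {zero}  f 1≤f = 1≤b
  ≥1 {suc n} f 1≤f = ℕP.⊓-glb (1≤f Fin.zero) (≥1 (f ∘ Fin.suc) (1≤f ∘ Fin.suc))
  ≤1 : ∀ {n} {f : Fin n → ℕ} j → f j ≡ 1 → foldr _⊓_ b (tabulate f) ≤ 1
  ≤1 Fin.zero    fⱼ≡1 = ℕP.≤-trans (ℕP.m⊓n≤m _ _) (ℕP.≤-reflexive fⱼ≡1)
  ≤1 (Fin.suc j) fⱼ≡1 = ℕP.≤-trans (ℕP.m⊓n≤n _ _) (≤1 j fⱼ≡1)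

module _ {n : ℕ} (G : Graph n) where

  degree≡degIn : ∀ v → degree G v ≡ degIn G (λ _ → true) v
  degree≡degIn v = length-filterᵇ-tabulate (adj G v) id

  N≡count : ∀ i → N G i ≡ count (λ v → degree G v ≡ᵇ i)
  N≡count i = length-filterᵇ-tabulate (λ v → degree G v ≡ᵇ i) id

  maxDeg≡ : maxDeg G ≡ foldr _⊔_ 0 (tabulate (degree G))
  maxDeg≡ = cong (foldr _⊔_ 0) (map-tabulate id (degree G))

  degree≤maxDeg : ∀ v → degree G v ≤ maxDeg G
  degree≤maxDeg v = subst (degree G v ≤_) (sym maxDeg≡) (≤-foldr-⊔ (degree G) v)

  minDeg≡1 : (∀ v → 1 ≤ degree G v) → ∀ l → degree G l ≡ 1 → minDeg G ≡ 1
  minDeg≡1 1≤deg l deg≡1 = trans (cong (foldr _⊓_ n) (map-tabulate id (degree G)))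
    (foldr-⊓≡1 n (degree G) (ℕP.<-≤-trans (s≤s z≤n) (FinP.toℕ<n l)) 1≤deg l deg≡1)

  edges≡ : edges G ≡ ∑[ u < n ] count (λ v → (Fin.toℕ u <ᵇ Fin.toℕ v) ∧ adj G u v)
  edges≡ = trans (cong sumₗ (map-tabulate id (λ u → length (filterᵇ (out u) (tabulate id)))))
    (trans (sumₗ-tabulate (λ u → length (filterᵇ (out u) (tabulate id)))) (sum-cong-≗ (λ u → length-filterᵇ-tabulate (out u) id)))
    where
    out : Fin n → Fin n → Bool
    out u v = (Fin.toℕ u <ᵇ Fin.toℕ v) ∧ adj G u v

  handshake : sum (degree G) ≡ edges G ℕ.+ edges G
  handshake = begin
    sum (degree G)                                            ≡⟨ sum-cong-≗ (λ u → trans (degree≡degIn u) (sum-cong-≗ (orient u))) ⟩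
    ∑[ u < n ] ∑[ v < n ] (E u v ℕ.+ E v u)                   ≡⟨ sum-cong-≗ (λ u → ∑-distrib-+ (E u) (λ v → E v u)) ⟩
    ∑[ u < n ] (sum (E u) ℕ.+ ∑[ v < n ] E v u)               ≡⟨ ∑-distrib-+ (λ u → sum (E u)) (λ u → ∑[ v < n ] E v u) ⟩
    ∑[ u < n ] sum (E u) ℕ.+ ∑[ u < n ] ∑[ v < n ] E v u      ≡⟨ cong (∑[ u < n ] sum (E u) ℕ.+_) (∑-comm (λ u v → E v u)) ⟩
    ∑[ u < n ] sum (E u) ℕ.+ ∑[ v < n ] sum (E v)             ≡⟨ sym (cong₂ ℕ._+_ edges≡ edges≡) ⟩
    edges G ℕ.+ edges G                                       ∎
    where
    open ≡-Reasoning
    E : Fin n → Fin n → ℕ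
    E u v = [ (Fin.toℕ u <ᵇ Fin.toℕ v) ∧ adj G u v ]
    orient : ∀ u v → [ adj G u v ] ≡ E u v ℕ.+ E v u
    orient u v with ℕP.<-cmp (Fin.toℕ u) (Fin.toℕ v)
    ... | tri< u<v _ v≮u rewrite T⇒≡true (ℕP.<⇒<ᵇ u<v) | ¬T⇒≡false (v≮u ∘ ℕP.<ᵇ⇒< _ _) = sym (ℕP.+-identityʳ _)
    ... | tri> u≮v _ v<u rewrite T⇒≡true (ℕP.<⇒<ᵇ v<u) | ¬T⇒≡false (u≮v ∘ ℕP.<ᵇ⇒< _ _) = cong [_] (Graph.sym G u v)
    ... | tri≈ _ u≡v _ rewrite FinP.toℕ-injective u≡v | Graph.irrefl G v | ¬T⇒≡false (ℕP.<-irrefl refl ∘ ℕP.<ᵇ⇒< (Fin.toℕ v) (Fin.toℕ v)) = refl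

maxDeg-attained : ∀ {n} (G : Graph (suc n)) → ∃ λ v → degree G v ≡ maxDeg G
maxDeg-attained G with foldr-⊔-attained (degree G)
... | v , eq = v , trans eq (sym (maxDeg≡ G))

walk⇒walkIn : ∀ {n} (G : Graph n) {u v} (ws : List (Fin n)) →
              Linked (Adj G) (u ∷ ws) → last (u ∷ ws) ≡ just v → WalkIn G (λ _ → true) u v
walk⇒walkIn G []       _        refl = here _
walk⇒walkIn G (x ∷ ws) (u~x ∷ l) eq  = step _ u~x (walk⇒walkIn G ws l eq)

module _ {k : ℕ} (G : Graph (suc k)) (tree : IsTree G) where

  tree-connectedIn : ConnectedIn G (λ _ → true)
  tree-connectedIn {u} {v} _ _ with proj₁ tree u v
  ... | ws , linked , ends = walk⇒walkIn G ws linked ends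

  degree-sum-tree : sum (degree G) ≡ k ℕ.+ k
  degree-sum-tree = trans (sum-cong-≗ (degree≡degIn G))
    (arcsIn-tree G (proj₂ tree) k (λ _ → true) (sum-ones (suc k)) tree-connectedIn)

module _ {m : ℕ} (G : Graph (2 ℕ.+ m)) (tree : IsTree G) where

  private
    two≤n : 2 ≤ count {2 ℕ.+ m} (λ _ → true)
    two≤n = subst (2 ≤_) (sym (sum-ones (2 ℕ.+ m))) (s≤s (s≤s z≤n))

  degree≥1-tree : ∀ v → 1 ≤ degree G v
  degree≥1-tree v = subst (1 ≤_) (sym (degree≡degIn G v))
    (degIn≥1 G (λ _ → true) (tree-connectedIn G tree) two≤n _)

  ∃leaf-tree : ∃ λ l → degree G l ≡ 1
  ∃leaf-tree with ∃leaf G (proj₂ tree) (λ _ → true) (tree-connectedIn G tree) two≤n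
  ... | l , _ , leaf = l , trans (degree≡degIn G l) leaf

  minDeg-tree : minDeg G ≡ 1
  minDeg-tree = minDeg≡1 G degree≥1-tree (proj₁ ∃leaf-tree) (proj₂ ∃leaf-tree)

-- Degree sequences of trees

module DegreeSequence {m : ℕ} (d : Fin (2 ℕ.+ m) → ℕ) (d≥1 : ∀ v → 1 ≤ d v) (d-sum : sum d ≡ suc m ℕ.+ suc m) where

  private
    n : ℕ
    n = 2 ℕ.+ m
    isLeaf : Fin n → ℕ
    isLeaf v = [ d v ≡ᵇ 1 ]

  -- excess is the Σ_{i=3}^{Δ} (i − 2) N_i of the statement.
  leaves excess : ℕ
  leaves = count (λ v → d v ≡ᵇ 1)
  excess = ∑[ v < n ] (d v ∸ 2)

  leaves≡2+excess : leaves ≡ 2 ℕ.+ excess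
  leaves≡2+excess = ℕP.+-cancelˡ-≡ (sum d) leaves (2 ℕ.+ excess) (begin
    sum d ℕ.+ leaves                      ≡⟨ sym (∑-distrib-+ d isLeaf) ⟩
    ∑[ v < n ] (d v ℕ.+ isLeaf v)         ≡⟨ sum-cong-≗ (λ v → per-vertex (d v) (d≥1 v)) ⟩
    ∑[ v < n ] ((d v ∸ 2) ℕ.+ 2 ℕ.* 1)    ≡⟨ ∑-+-* (λ v → d v ∸ 2) (λ _ → 1) 2 ⟩
    excess ℕ.+ 2 ℕ.* ∑[ v < n ] 1         ≡⟨ cong (λ c → excess ℕ.+ 2 ℕ.* c) (sum-ones n) ⟩
    excess ℕ.+ 2 ℕ.* n                    ≡⟨ arith m excess ⟩
    suc m ℕ.+ suc m ℕ.+ (2 ℕ.+ excess)    ≡⟨ cong (ℕ._+ (2 ℕ.+ excess)) (sym d-sum) ⟩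
    sum d ℕ.+ (2 ℕ.+ excess)              ∎)
    where
    open ≡-Reasoning
    per-vertex : ∀ x → 1 ≤ x → x ℕ.+ [ x ≡ᵇ 1 ] ≡ (x ∸ 2) ℕ.+ 2 ℕ.* 1
    per-vertex 1 _ = refl
    per-vertex (suc (suc e)) _ = trans (ℕP.+-identityʳ _) (ℕP.+-comm 2 e)
    arith : ∀ m p → p ℕ.+ 2 ℕ.* (2 ℕ.+ m) ≡ suc m ℕ.+ suc m ℕ.+ (2 ℕ.+ p)
    arith = solve-∀

  -- n |x − 2(n − 1)/n|, the average degree of a tree being 2(n − 1)/n.
  deviation : ℕ → ℕ
  deviation x = ∣ x ℕ.* n - 2 ℕ.* suc m ∣ₙ

  deviation-leaf : deviation 1 ≡ m
  deviation-leaf = trans (cong ∣ 1 ℕ.* n -_∣ₙ (arith m)) (ℕP.∣m-m+n∣≡n (1 ℕ.* n) m)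
    where
    arith : ∀ m → 2 ℕ.* suc m ≡ 1 ℕ.* (2 ℕ.+ m) ℕ.+ m
    arith = solve-∀

  deviation-inner : ∀ e → deviation (2 ℕ.+ e) ≡ e ℕ.* n ℕ.+ 2
  deviation-inner e = begin
    ∣ (2 ℕ.+ e) ℕ.* n - 2 ℕ.* suc m ∣ₙ                         ≡⟨ cong ∣_- 2 ℕ.* suc m ∣ₙ (arith m e) ⟩
    ∣ 2 ℕ.* suc m ℕ.+ (e ℕ.* n ℕ.+ 2) - 2 ℕ.* suc m ∣ₙ         ≡⟨ ℕP.∣-∣-comm (2 ℕ.* suc m ℕ.+ (e ℕ.* n ℕ.+ 2)) (2 ℕ.* suc m) ⟩
    ∣ 2 ℕ.* suc m - 2 ℕ.* suc m ℕ.+ (e ℕ.* n ℕ.+ 2) ∣ₙ         ≡⟨ ℕP.∣m-m+n∣≡n (2 ℕ.* suc m) (e ℕ.* n ℕ.+ 2) ⟩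
    e ℕ.* n ℕ.+ 2                                              ∎
    where
    open ≡-Reasoning
    arith : ∀ m e → (2 ℕ.+ e) ℕ.* (2 ℕ.+ m) ≡ 2 ℕ.* suc m ℕ.+ (e ℕ.* (2 ℕ.+ m) ℕ.+ 2)
    arith = solve-∀

  -- Both sides are shifted by 2 · leaves so that the per-vertex identity involves no subtraction.
  ∑-deviation : ∑[ v < n ] deviation (d v) ≡ 4 ℕ.* m ℕ.+ 2 ℕ.* m ℕ.* excess
  ∑-deviation = ℕP.+-cancelʳ-≡ (2 ℕ.* leaves) _ _ (begin
    ∑[ v < n ] deviation (d v) ℕ.+ 2 ℕ.* leaves
      ≡⟨ sym (∑-+-* (deviation ∘ d) isLeaf 2) ⟩
    ∑[ v < n ] (deviation (d v) ℕ.+ 2 ℕ.* isLeaf v)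
      ≡⟨ sum-cong-≗ (λ v → per-vertex (d v) (d≥1 v)) ⟩
    ∑[ v < n ] (m ℕ.* isLeaf v ℕ.+ (2 ℕ.* 1 ℕ.+ n ℕ.* (d v ∸ 2)))
      ≡⟨ trans (∑-*-+ m isLeaf (λ v → 2 ℕ.* 1 ℕ.+ n ℕ.* (d v ∸ 2)))
               (cong (m ℕ.* leaves ℕ.+_) (∑-*-+-* 2 (λ _ → 1) n (λ v → d v ∸ 2))) ⟩
    m ℕ.* leaves ℕ.+ (2 ℕ.* ∑[ v < n ] 1 ℕ.+ n ℕ.* excess)
      ≡⟨ cong₂ (λ l c → m ℕ.* l ℕ.+ (2 ℕ.* c ℕ.+ n ℕ.* excess)) leaves≡2+excess (sum-ones n) ⟩
    m ℕ.* (2 ℕ.+ excess) ℕ.+ (2 ℕ.* n ℕ.+ n ℕ.* excess)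
      ≡⟨ arith m excess ⟩
    4 ℕ.* m ℕ.+ 2 ℕ.* m ℕ.* excess ℕ.+ 2 ℕ.* (2 ℕ.+ excess)
      ≡⟨ cong (λ l → 4 ℕ.* m ℕ.+ 2 ℕ.* m ℕ.* excess ℕ.+ 2 ℕ.* l) (sym leaves≡2+excess) ⟩
    4 ℕ.* m ℕ.+ 2 ℕ.* m ℕ.* excess ℕ.+ 2 ℕ.* leaves ∎)
    where
    open ≡-Reasoning
    leaf-case : ∀ m → m ℕ.+ 2 ℕ.* 1 ≡ m ℕ.* 1 ℕ.+ (2 ℕ.* 1 ℕ.+ (2 ℕ.+ m) ℕ.* 0)
    leaf-case = solve-∀
    inner-case : ∀ m e → e ℕ.* (2 ℕ.+ m) ℕ.+ 2 ℕ.+ 2 ℕ.* 0 ≡ m ℕ.* 0 ℕ.+ (2 ℕ.* 1 ℕ.+ (2 ℕ.+ m) ℕ.* e)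
    inner-case = solve-∀
    per-vertex : ∀ x → 1 ≤ x → deviation x ℕ.+ 2 ℕ.* [ x ≡ᵇ 1 ] ≡ m ℕ.* [ x ≡ᵇ 1 ] ℕ.+ (2 ℕ.* 1 ℕ.+ n ℕ.* (x ∸ 2))
    per-vertex 1 _ rewrite deviation-leaf = leaf-case m
    per-vertex (suc (suc e)) _ rewrite deviation-inner e = inner-case m e
    arith : ∀ m p → m ℕ.* (2 ℕ.+ p) ℕ.+ (2 ℕ.* (2 ℕ.+ m) ℕ.+ (2 ℕ.+ m) ℕ.* p)
                  ≡ 4 ℕ.* m ℕ.+ 2 ℕ.* m ℕ.* p ℕ.+ 2 ℕ.* (2 ℕ.+ p)
    arith = solve-∀

  ∑-deviation² : ∑[ v < n ] (deviation (d v) ℕ.* deviation (d v))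
                 ≡ 2 ℕ.* m ℕ.* n ℕ.+ n ℕ.* n ℕ.* ∑[ v < n ] ((d v ∸ 1) ℕ.* (d v ∸ 2))
  ∑-deviation² = ℕP.+-cancelʳ-≡ (4 ℕ.* leaves ℕ.+ n² ℕ.* excess) _ _ (begin
    ∑dev² ℕ.+ (4 ℕ.* leaves ℕ.+ n² ℕ.* excess)
      ≡⟨ cong (∑dev² ℕ.+_) (sym (∑-*-+-* 4 isLeaf n² (λ v → d v ∸ 2))) ⟩
    ∑dev² ℕ.+ ∑[ v < n ] (4 ℕ.* isLeaf v ℕ.+ n² ℕ.* (d v ∸ 2))
      ≡⟨ sym (∑-distrib-+ (λ v → deviation (d v) ℕ.* deviation (d v)) (λ v → 4 ℕ.* isLeaf v ℕ.+ n² ℕ.* (d v ∸ 2))) ⟩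
    ∑[ v < n ] (deviation (d v) ℕ.* deviation (d v) ℕ.+ (4 ℕ.* isLeaf v ℕ.+ n² ℕ.* (d v ∸ 2)))
      ≡⟨ sum-cong-≗ (λ v → per-vertex (d v) (d≥1 v)) ⟩
    ∑[ v < n ] (m ℕ.* m ℕ.* isLeaf v ℕ.+ (4 ℕ.* 1 ℕ.+ 4 ℕ.* n ℕ.* (d v ∸ 2)) ℕ.+ n² ℕ.* Q v)
      ≡⟨ trans (∑-+-* (λ v → m ℕ.* m ℕ.* isLeaf v ℕ.+ (4 ℕ.* 1 ℕ.+ 4 ℕ.* n ℕ.* (d v ∸ 2))) Q n²)
          (cong (ℕ._+ n² ℕ.* sum Q) (trans (∑-*-+ (m ℕ.* m) isLeaf (λ v → 4 ℕ.* 1 ℕ.+ 4 ℕ.* n ℕ.* (d v ∸ 2)))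
            (cong (m ℕ.* m ℕ.* leaves ℕ.+_) (∑-*-+-* 4 (λ _ → 1) (4 ℕ.* n) (λ v → d v ∸ 2))))) ⟩
    m ℕ.* m ℕ.* leaves ℕ.+ (4 ℕ.* ∑[ v < n ] 1 ℕ.+ 4 ℕ.* n ℕ.* excess) ℕ.+ n² ℕ.* sum Q
      ≡⟨ cong₂ (λ l c → m ℕ.* m ℕ.* l ℕ.+ (4 ℕ.* c ℕ.+ 4 ℕ.* n ℕ.* excess) ℕ.+ n² ℕ.* sum Q) leaves≡2+excess (sum-ones n) ⟩
    m ℕ.* m ℕ.* (2 ℕ.+ excess) ℕ.+ (4 ℕ.* n ℕ.+ 4 ℕ.* n ℕ.* excess) ℕ.+ n² ℕ.* sum Q
      ≡⟨ arith m excess (sum Q) ⟩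
    2 ℕ.* m ℕ.* n ℕ.+ n² ℕ.* sum Q ℕ.+ (4 ℕ.* (2 ℕ.+ excess) ℕ.+ n² ℕ.* excess)
      ≡⟨ cong (λ l → 2 ℕ.* m ℕ.* n ℕ.+ n² ℕ.* sum Q ℕ.+ (4 ℕ.* l ℕ.+ n² ℕ.* excess)) (sym leaves≡2+excess) ⟩
    2 ℕ.* m ℕ.* n ℕ.+ n² ℕ.* sum Q ℕ.+ (4 ℕ.* leaves ℕ.+ n² ℕ.* excess) ∎)
    where
    open ≡-Reasoning
    n² : ℕ
    n² = n ℕ.* n
    Q : Fin n → ℕ
    Q v = (d v ∸ 1) ℕ.* (d v ∸ 2)
    ∑dev² : ℕ
    ∑dev² = ∑[ v < n ] (deviation (d v) ℕ.* deviation (d v))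
    leaf-case : ∀ m → m ℕ.* m ℕ.+ (4 ℕ.* 1 ℕ.+ (2 ℕ.+ m) ℕ.* (2 ℕ.+ m) ℕ.* 0)
                    ≡ m ℕ.* m ℕ.* 1 ℕ.+ (4 ℕ.* 1 ℕ.+ 4 ℕ.* (2 ℕ.+ m) ℕ.* 0) ℕ.+ (2 ℕ.+ m) ℕ.* (2 ℕ.+ m) ℕ.* (0 ℕ.* 0)
    leaf-case = solve-∀
    inner-case : ∀ m e → (e ℕ.* (2 ℕ.+ m) ℕ.+ 2) ℕ.* (e ℕ.* (2 ℕ.+ m) ℕ.+ 2) ℕ.+ (4 ℕ.* 0 ℕ.+ (2 ℕ.+ m) ℕ.* (2 ℕ.+ m) ℕ.* e)
                     ≡ m ℕ.* m ℕ.* 0 ℕ.+ (4 ℕ.* 1 ℕ.+ 4 ℕ.* (2 ℕ.+ m) ℕ.* e) ℕ.+ (2 ℕ.+ m) ℕ.* (2 ℕ.+ m) ℕ.* (suc e ℕ.* e)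
    inner-case = solve-∀
    per-vertex : ∀ x → 1 ≤ x → deviation x ℕ.* deviation x ℕ.+ (4 ℕ.* [ x ≡ᵇ 1 ] ℕ.+ n² ℕ.* (x ∸ 2))
                 ≡ m ℕ.* m ℕ.* [ x ≡ᵇ 1 ] ℕ.+ (4 ℕ.* 1 ℕ.+ 4 ℕ.* n ℕ.* (x ∸ 2)) ℕ.+ n² ℕ.* ((x ∸ 1) ℕ.* (x ∸ 2))
    per-vertex 1 _ rewrite deviation-leaf = leaf-case m
    per-vertex (suc (suc e)) _ rewrite deviation-inner e = inner-case m e
    arith : ∀ m p q → m ℕ.* m ℕ.* (2 ℕ.+ p) ℕ.+ (4 ℕ.* (2 ℕ.+ m) ℕ.+ 4 ℕ.* (2 ℕ.+ m) ℕ.* p) ℕ.+ (2 ℕ.+ m) ℕ.* (2 ℕ.+ m) ℕ.* q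
                    ≡ 2 ℕ.* m ℕ.* (2 ℕ.+ m) ℕ.+ (2 ℕ.+ m) ℕ.* (2 ℕ.+ m) ℕ.* q ℕ.+ (4 ℕ.* (2 ℕ.+ p) ℕ.+ (2 ℕ.+ m) ℕ.* (2 ℕ.+ m) ℕ.* p)
    arith = solve-∀

module _ {n : ℕ} (d : Fin n → ℕ) (Δ : ℕ) where

  private
    ≤-excess : ∀ x → (Δ ∸ 2) ℕ.* [ x ≡ᵇ Δ ] ≤ x ∸ 2
    ≤-excess x with x ≡ᵇ Δ in eq
    ... | false = subst (_≤ x ∸ 2) (sym (ℕP.*-zeroʳ (Δ ∸ 2))) z≤n
    ... | true rewrite ℕP.≡ᵇ⇒≡ x Δ (subst T (sym eq) _) = ℕP.≤-reflexive (ℕP.*-identityʳ (Δ ∸ 2))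

    ofDegΔ-sum : (Δ ∸ 2) ℕ.* count (λ v → d v ≡ᵇ Δ) ≡ ∑[ v < n ] ((Δ ∸ 2) ℕ.* [ d v ≡ᵇ Δ ])
    ofDegΔ-sum = *-distribˡ-sum (Δ ∸ 2) (λ v → [ d v ≡ᵇ Δ ])

  excess≥ : (Δ ∸ 2) ℕ.* count (λ v → d v ≡ᵇ Δ) ≤ ∑[ v < n ] (d v ∸ 2)
  excess≥ = subst (_≤ _) (sym ofDegΔ-sum) (sum-mono-≤ (≤-excess ∘ d))

  excess≡⇒degrees : (∀ v → 1 ≤ d v) → (Δ ∸ 2) ℕ.* count (λ v → d v ≡ᵇ Δ) ≡ ∑[ v < n ] (d v ∸ 2) →
                    ∀ v → d v ≡ 1 ⊎ d v ≡ 2 ⊎ d v ≡ Δ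
  excess≡⇒degrees d≥1 eq v =
    degree-of (d v) (d≥1 v) (sum-mono-≤-tight (≤-excess ∘ d) (ℕP.≤-reflexive (trans (sym eq) ofDegΔ-sum)) v)
    where
    degree-of : ∀ x → 1 ≤ x → (Δ ∸ 2) ℕ.* [ x ≡ᵇ Δ ] ≡ x ∸ 2 → x ≡ 1 ⊎ x ≡ 2 ⊎ x ≡ Δ
    degree-of x _ eq with x ≡ᵇ Δ in isΔ
    degree-of x                   _ _  | true  = inj₂ (inj₂ (ℕP.≡ᵇ⇒≡ x Δ (subst T (sym isΔ) _)))
    degree-of 1                   _ _  | false = inj₁ refl
    degree-of 2                   _ _  | false = inj₂ (inj₁ refl)
    degree-of (suc (suc (suc e))) _ eq | false = ⊥-elim (ℕP.0≢1+n (trans (sym (ℕP.*-zeroʳ (Δ ∸ 2))) eq))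

  degrees⇒excess≡ : (∀ v → d v ≡ 1 ⊎ d v ≡ 2 ⊎ d v ≡ Δ) → (Δ ∸ 2) ℕ.* count (λ v → d v ≡ᵇ Δ) ≡ ∑[ v < n ] (d v ∸ 2)
  degrees⇒excess≡ degs = trans ofDegΔ-sum (sum-cong-≗ (λ v → pointwise (d v) (degs v)))
    where
    pointwise : ∀ x → x ≡ 1 ⊎ x ≡ 2 ⊎ x ≡ Δ → (Δ ∸ 2) ℕ.* [ x ≡ᵇ Δ ] ≡ x ∸ 2
    pointwise x deg with x ≡ᵇ Δ in isΔ | deg
    ... | true  | _ rewrite ℕP.≡ᵇ⇒≡ x Δ (subst T (sym isΔ) _) = ℕP.*-identityʳ (Δ ∸ 2)
    ... | false | inj₁ refl        = ℕP.*-zeroʳ (Δ ∸ 2)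
    ... | false | inj₂ (inj₁ refl) = ℕP.*-zeroʳ (Δ ∸ 2)
    ... | false | inj₂ (inj₂ refl) = ⊥-elim (subst T isΔ (ℕP.≡⇒≡ᵇ x x refl))

ℕ→ℚ-normal : ∀ a → ℕ→ℚ a ≡ mkℚ (ℤ.+ a) 0 (Coprime.sym (Coprime.1-coprimeTo a))
ℕ→ℚ-normal a = ℚP.normalize-coprime (Coprime.sym (Coprime.1-coprimeTo a))

ℕ→ℚ-+ : ∀ a b → ℕ→ℚ (a ℕ.+ b) ≡ ℕ→ℚ a + ℕ→ℚ b
ℕ→ℚ-+ a b = sym (trans (cong₂ _+_ (ℕ→ℚ-normal a) (ℕ→ℚ-normal b))
  (cong (_/ 1) (trans (cong₂ ℤ._+_ (ℤP.*-identityʳ (ℤ.+ a)) (ℤP.*-identityʳ (ℤ.+ b))) (sym (ℤP.pos-+ a b)))))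

ℕ→ℚ-* : ∀ a b → ℕ→ℚ (a ℕ.* b) ≡ ℕ→ℚ a * ℕ→ℚ b
ℕ→ℚ-* a b = sym (trans (cong₂ _*_ (ℕ→ℚ-normal a) (ℕ→ℚ-normal b)) (cong (_/ 1) (sym (ℤP.pos-* a b))))

ℕ→ℚ-sum : ∀ {n} (f : Fin n → ℕ) → ℕ→ℚ (sum f) ≡ ℚΣ.sum (ℕ→ℚ ∘ f)
ℕ→ℚ-sum {zero}  f = refl
ℕ→ℚ-sum {suc n} f = trans (ℕ→ℚ-+ (f Fin.zero) _) (cong (λ x → ℕ→ℚ (f Fin.zero) + x) (ℕ→ℚ-sum (f ∘ Fin.suc)))

sumℚ-map-applyUpTo : ∀ (F : ℕ → ℚ) (f : ℕ → ℕ) r → sumℚ (map F (applyUpTo f r)) ≡ ℚΣ.sum {r} (λ k → F (f (Fin.toℕ k)))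
sumℚ-map-applyUpTo F f zero    = refl
sumℚ-map-applyUpTo F f (suc r) = cong (F (f 0) +_) (sumℚ-map-applyUpTo F (f ∘ suc) r)

sumℚ-map-tabulate : ∀ {A : Set} {n} (h : A → ℚ) (g : Fin n → A) → sumℚ (map h (tabulate g)) ≡ ℚΣ.sum (h ∘ g)
sumℚ-map-tabulate {n = zero}  h g = refl
sumℚ-map-tabulate {n = suc n} h g = cong (h (g Fin.zero) +_) (sumℚ-map-tabulate h (g ∘ Fin.suc))

ℕ→ℚ-nonNeg : ∀ a → 0ℚ ≤ℚ ℕ→ℚ a
ℕ→ℚ-nonNeg a = subst (0ℚ ≤ℚ_) (sym (ℕ→ℚ-normal a)) (ℚP.nonNegative⁻¹ _)

ℕ→ℚ-∸ : ∀ {a b} → b ≤ a → ℕ→ℚ a - ℕ→ℚ b ≡ ℕ→ℚ (a ∸ b)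
ℕ→ℚ-∸ {a} {b} b≤a = begin
  ℕ→ℚ a - ℕ→ℚ b                    ≡⟨ cong (λ x → ℕ→ℚ x - ℕ→ℚ b) (sym (ℕP.m+[n∸m]≡n b≤a)) ⟩
  ℕ→ℚ (b ℕ.+ (a ∸ b)) - ℕ→ℚ b      ≡⟨ cong (_- ℕ→ℚ b) (ℕ→ℚ-+ b (a ∸ b)) ⟩
  ℕ→ℚ b + ℕ→ℚ (a ∸ b) - ℕ→ℚ b      ≡⟨ x+y-x≡y (ℕ→ℚ b) (ℕ→ℚ (a ∸ b)) ⟩
  ℕ→ℚ (a ∸ b)                       ∎
  where
  open ≡-Reasoning
  x+y-x≡y : ∀ x y → x + y - x ≡ y
  x+y-x≡y = solve 2 (λ x y → x :+ y :- x := y) refl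

ℕ→ℚ-difference : ∀ a b → (ℕ→ℚ a - ℕ→ℚ b ≡ ℕ→ℚ ∣ a - b ∣ₙ) ⊎ (ℕ→ℚ a - ℕ→ℚ b ≡ - ℕ→ℚ ∣ a - b ∣ₙ)
ℕ→ℚ-difference a b with ℕP.≤-total b a
... | inj₁ b≤a = inj₁ (trans (ℕ→ℚ-∸ b≤a) (cong ℕ→ℚ (sym (ℕP.m≤n⇒∣n-m∣≡n∸m b≤a))))
... | inj₂ a≤b = inj₂ (trans (x-y≡-[y-x] (ℕ→ℚ a) (ℕ→ℚ b))
                     (cong -_ (trans (ℕ→ℚ-∸ a≤b) (cong ℕ→ℚ (sym (ℕP.m≤n⇒∣m-n∣≡n∸m a≤b))))))
  where
  x-y≡-[y-x] : ∀ x y → x - y ≡ - (y - x)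
  x-y≡-[y-x] = solve 2 (λ x y → x :- y := :- (y :- x)) refl

∣ℕ→ℚ-ℕ→ℚ∣ : ∀ a b → ∣ ℕ→ℚ a - ℕ→ℚ b ∣ ≡ ℕ→ℚ ∣ a - b ∣ₙ
∣ℕ→ℚ-ℕ→ℚ∣ a b with ℕ→ℚ-difference a b
... | inj₁ eq = trans (cong ∣_∣ eq) (ℚP.0≤p⇒∣p∣≡p (ℕ→ℚ-nonNeg ∣ a - b ∣ₙ))
... | inj₂ eq = trans (cong ∣_∣ eq) (trans (ℚP.∣-p∣≡∣p∣ (ℕ→ℚ ∣ a - b ∣ₙ)) (ℚP.0≤p⇒∣p∣≡p (ℕ→ℚ-nonNeg ∣ a - b ∣ₙ)))

[ℕ→ℚ-ℕ→ℚ]² : ∀ a b → (ℕ→ℚ a - ℕ→ℚ b) * (ℕ→ℚ a - ℕ→ℚ b) ≡ ℕ→ℚ (∣ a - b ∣ₙ ℕ.* ∣ a - b ∣ₙ)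
[ℕ→ℚ-ℕ→ℚ]² a b with ℕ→ℚ-difference a b
... | inj₁ eq = trans (cong₂ _*_ eq eq) (sym (ℕ→ℚ-* ∣ a - b ∣ₙ ∣ a - b ∣ₙ))
... | inj₂ eq = trans (cong₂ _*_ eq eq) (trans (-x*-x≡x*x (ℕ→ℚ ∣ a - b ∣ₙ)) (sym (ℕ→ℚ-* ∣ a - b ∣ₙ ∣ a - b ∣ₙ)))
  where
  -x*-x≡x*x : ∀ x → - x * - x ≡ x * x
  -x*-x≡x*x = solve 1 (λ x → (:- x) :* (:- x) := x :* x) refl

1/suc : ℕ → ℚ
1/suc k = ℤ.+ 1 / suc k

1/suc-normal : ∀ k → 1/suc k ≡ mkℚ (ℤ.+ 1) k (Coprime.1-coprimeTo (suc k))
1/suc-normal k = ℚP.normalize-coprime (Coprime.1-coprimeTo (suc k))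

ℕ→ℚ-*-1/suc : ∀ k → ℕ→ℚ (suc k) * 1/suc k ≡ 1ℚ
ℕ→ℚ-*-1/suc k = trans (cong₂ _*_ (ℕ→ℚ-normal (suc k)) (1/suc-normal k))
  (ℚP.fromℚᵘ-cong {mkℚᵘ (ℤ.+ suc k ℤ.* ℤ.+ 1) (k ℕ.+ 0)} {mkℚᵘ (ℤ.+ 1) 0} (*≡* (trans (ℤP.*-identityʳ _) (trans (ℤP.*-identityʳ _)
    (trans (cong (λ j → ℤ.+ suc j) (sym (ℕP.+-identityʳ k))) (sym (ℤP.*-identityˡ _)))))))
  where open import Data.Rational.Unnormalised using (mkℚᵘ; *≡*)

1/suc-nonNeg : ∀ k → 0ℚ ≤ℚ 1/suc k
1/suc-nonNeg k = subst (0ℚ ≤ℚ_) (sym (1/suc-normal k)) (ℚP.nonNegative⁻¹ _)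

1/suc-antimono-≤ : ∀ {a b} → b ≤ a → 1/suc a ≤ℚ 1/suc b
1/suc-antimono-≤ {a} {b} b≤a rewrite 1/suc-normal a | 1/suc-normal b =
  ℚ.*≤* (subst₂ ℤ._≤_ (sym (ℤP.*-identityˡ _)) (sym (ℤP.*-identityˡ _)) (ℤ.+≤+ (s≤s b≤a)))

1/suc-injective : ∀ {a b} → 1/suc a ≡ 1/suc b → a ≡ b
1/suc-injective {a} {b} eq = ℕP.suc-injective (cong ℚ.↧ₙ_ (trans (sym (1/suc-normal a)) (trans eq (1/suc-normal b))))

ℕ→ℚ-*-cancelˡ : ∀ {c x y} → 1 ≤ c → ℕ→ℚ c * x ≡ ℕ→ℚ c * y → x ≡ y
ℕ→ℚ-*-cancelˡ {suc k} {x} {y} _ eq = begin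
  x                                ≡⟨ sym (ℚP.*-identityˡ x) ⟩
  1ℚ * x                           ≡⟨ cong (_* x) (sym (ℕ→ℚ-*-1/suc k)) ⟩
  ℕ→ℚ (suc k) * 1/suc k * x        ≡⟨ reassoc (ℕ→ℚ (suc k)) (1/suc k) x ⟩
  1/suc k * (ℕ→ℚ (suc k) * x)      ≡⟨ cong (1/suc k *_) eq ⟩
  1/suc k * (ℕ→ℚ (suc k) * y)      ≡⟨ sym (reassoc (ℕ→ℚ (suc k)) (1/suc k) y) ⟩
  ℕ→ℚ (suc k) * 1/suc k * y        ≡⟨ cong (_* y) (ℕ→ℚ-*-1/suc k) ⟩
  1ℚ * y                           ≡⟨ ℚP.*-identityˡ y ⟩
  y                                ∎
  where
  open ≡-Reasoning
  reassoc : ∀ a r z → a * r * z ≡ r * (a * z)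
  reassoc = solve 3 (λ a r z → a :* r :* z := r :* (a :* z)) refl

1/suc-* : ∀ a b c → suc c ≡ suc a ℕ.* suc b → 1/suc c ≡ 1/suc a * 1/suc b
1/suc-* a b c eq = ℕ→ℚ-*-cancelˡ {suc c} (s≤s z≤n) (begin
  ℕ→ℚ (suc c) * 1/suc c                                     ≡⟨ ℕ→ℚ-*-1/suc c ⟩
  1ℚ                                                         ≡⟨ sym (cong₂ _*_ (ℕ→ℚ-*-1/suc a) (ℕ→ℚ-*-1/suc b)) ⟩
  ℕ→ℚ (suc a) * 1/suc a * (ℕ→ℚ (suc b) * 1/suc b)           ≡⟨ interchange (ℕ→ℚ (suc a)) (1/suc a) (ℕ→ℚ (suc b)) (1/suc b) ⟩
  ℕ→ℚ (suc a) * ℕ→ℚ (suc b) * (1/suc a * 1/suc b)           ≡⟨ cong (_* (1/suc a * 1/suc b)) (sym (trans (cong ℕ→ℚ eq) (ℕ→ℚ-* (suc a) (suc b)))) ⟩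
  ℕ→ℚ (suc c) * (1/suc a * 1/suc b)                         ∎)
  where
  open ≡-Reasoning
  interchange : ∀ x r y s → x * r * (y * s) ≡ x * y * (r * s)
  interchange = solve 4 (λ x r y s → x :* r :* (y :* s) := x :* y :* (r :* s)) refl

ℕ→ℚ-over-suc : ∀ k a b → ℕ→ℚ a - ℕ→ℚ b * 1/suc k ≡ (ℕ→ℚ (a ℕ.* suc k) - ℕ→ℚ b) * 1/suc k
ℕ→ℚ-over-suc k a b = sym (begin
  (ℕ→ℚ (a ℕ.* suc k) - ℕ→ℚ b) * 1/suc k                   ≡⟨ cong (λ x → (x - ℕ→ℚ b) * 1/suc k) (ℕ→ℚ-* a (suc k)) ⟩
  (ℕ→ℚ a * ℕ→ℚ (suc k) - ℕ→ℚ b) * 1/suc k                 ≡⟨ distrib (ℕ→ℚ a) (ℕ→ℚ (suc k)) (ℕ→ℚ b) (1/suc k) ⟩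
  ℕ→ℚ a * (ℕ→ℚ (suc k) * 1/suc k) - ℕ→ℚ b * 1/suc k       ≡⟨ cong (λ x → ℕ→ℚ a * x - ℕ→ℚ b * 1/suc k) (ℕ→ℚ-*-1/suc k) ⟩
  ℕ→ℚ a * 1ℚ - ℕ→ℚ b * 1/suc k                            ≡⟨ cong (_- ℕ→ℚ b * 1/suc k) (ℚP.*-identityʳ (ℕ→ℚ a)) ⟩
  ℕ→ℚ a - ℕ→ℚ b * 1/suc k                                 ∎)
  where
  open ≡-Reasoning
  distrib : ∀ x y z r → (x * y - z) * r ≡ x * (y * r) - z * r
  distrib = solve 4 (λ x y z r → (x :* y :- z) :* r := x :* (y :* r) :- z :* r) refl

∣ℕ→ℚ-over-suc∣ : ∀ k a b → ∣ ℕ→ℚ a - ℕ→ℚ b * 1/suc k ∣ ≡ ℕ→ℚ ∣ a ℕ.* suc k - b ∣ₙ * 1/suc k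
∣ℕ→ℚ-over-suc∣ k a b = begin
  ∣ ℕ→ℚ a - ℕ→ℚ b * 1/suc k ∣                        ≡⟨ cong ∣_∣ (ℕ→ℚ-over-suc k a b) ⟩
  ∣ (ℕ→ℚ (a ℕ.* suc k) - ℕ→ℚ b) * 1/suc k ∣          ≡⟨ ℚP.∣p*q∣≡∣p∣*∣q∣ (ℕ→ℚ (a ℕ.* suc k) - ℕ→ℚ b) (1/suc k) ⟩
  ∣ ℕ→ℚ (a ℕ.* suc k) - ℕ→ℚ b ∣ * ∣ 1/suc k ∣        ≡⟨ cong₂ _*_ (∣ℕ→ℚ-ℕ→ℚ∣ (a ℕ.* suc k) b) (ℚP.0≤p⇒∣p∣≡p (1/suc-nonNeg k)) ⟩
  ℕ→ℚ ∣ a ℕ.* suc k - b ∣ₙ * 1/suc k                 ∎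
  where open ≡-Reasoning

[ℕ→ℚ-over-suc]² : ∀ k a b → (ℕ→ℚ a - ℕ→ℚ b * 1/suc k) * (ℕ→ℚ a - ℕ→ℚ b * 1/suc k)
                            ≡ ℕ→ℚ (∣ a ℕ.* suc k - b ∣ₙ ℕ.* ∣ a ℕ.* suc k - b ∣ₙ) * (1/suc k * 1/suc k)
[ℕ→ℚ-over-suc]² k a b = begin
  (ℕ→ℚ a - ℕ→ℚ b * 1/suc k) * (ℕ→ℚ a - ℕ→ℚ b * 1/suc k)   ≡⟨ cong (λ x → x * x) (ℕ→ℚ-over-suc k a b) ⟩
  (δ * 1/suc k) * (δ * 1/suc k)                             ≡⟨ interchange δ (1/suc k) ⟩
  δ * δ * (1/suc k * 1/suc k)                               ≡⟨ cong (_* (1/suc k * 1/suc k)) ([ℕ→ℚ-ℕ→ℚ]² (a ℕ.* suc k) b) ⟩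
  ℕ→ℚ (∣ a ℕ.* suc k - b ∣ₙ ℕ.* ∣ a ℕ.* suc k - b ∣ₙ) * (1/suc k * 1/suc k) ∎
  where
  open ≡-Reasoning
  δ = ℕ→ℚ (a ℕ.* suc k) - ℕ→ℚ b
  interchange : ∀ x r → x * r * (x * r) ≡ x * x * (r * r)
  interchange = solve 2 (λ x r → x :* r :* (x :* r) := x :* x :* (r :* r)) refl

ℕ→ℚ-over-suc³ : ∀ k a b → ℕ→ℚ (a ℕ.* suc k ℕ.+ suc k ℕ.* suc k ℕ.* b) * (1/suc k * 1/suc k) * 1/suc k
                           ≡ ℕ→ℚ a * (1/suc k * 1/suc k) + ℕ→ℚ b * 1/suc k
ℕ→ℚ-over-suc³ k a b = begin
  ℕ→ℚ (a ℕ.* suc k ℕ.+ suc k ℕ.* suc k ℕ.* b) * (r * r) * r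
    ≡⟨ cong (λ x → x * (r * r) * r) (trans (ℕ→ℚ-+ (a ℕ.* suc k) (suc k ℕ.* suc k ℕ.* b))
         (cong₂ _+_ (ℕ→ℚ-* a (suc k)) (trans (ℕ→ℚ-* (suc k ℕ.* suc k) b) (cong (_* ℕ→ℚ b) (ℕ→ℚ-* (suc k) (suc k)))))) ⟩
  (ℕ→ℚ a * ℕ→ℚ (suc k) + ℕ→ℚ (suc k) * ℕ→ℚ (suc k) * ℕ→ℚ b) * (r * r) * r
    ≡⟨ regroup (ℕ→ℚ a) (ℕ→ℚ b) (ℕ→ℚ (suc k)) r ⟩
  ℕ→ℚ a * (r * r) * (ℕ→ℚ (suc k) * r) + ℕ→ℚ b * r * (ℕ→ℚ (suc k) * r * (ℕ→ℚ (suc k) * r))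
    ≡⟨ cong (λ one → ℕ→ℚ a * (r * r) * one + ℕ→ℚ b * r * (one * one)) (ℕ→ℚ-*-1/suc k) ⟩
  ℕ→ℚ a * (r * r) * 1ℚ + ℕ→ℚ b * r * (1ℚ * 1ℚ)
    ≡⟨ drop-ones (ℕ→ℚ a) (ℕ→ℚ b) r ⟩
  ℕ→ℚ a * (r * r) + ℕ→ℚ b * r ∎
  where
  open ≡-Reasoning
  r = 1/suc k
  regroup : ∀ a b x r → (a * x + x * x * b) * (r * r) * r ≡ a * (r * r) * (x * r) + b * r * (x * r * (x * r))
  regroup = solve 4 (λ a b x r → (a :* x :+ x :* x :* b) :* (r :* r) :* r := a :* (r :* r) :* (x :* r) :+ b :* r :* (x :* r :* (x :* r))) refl
  drop-ones : ∀ a b r → a * (r * r) * 1ℚ + b * r * (1ℚ * 1ℚ) ≡ a * (r * r) + b * r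
  drop-ones = solve 3 (λ a b r → a :* (r :* r) :* con 1ℚ :+ b :* r :* (con 1ℚ :* con 1ℚ) := a :* (r :* r) :+ b :* r) refl

module _ {n : ℕ} (G : Graph n) where

  ∑-degree-classes : ∀ (H : ℕ → ℕ) → H 0 ≡ 0 → H 1 ≡ 0 → H 2 ≡ 0 →
    ∑[ k < maxDeg G ∸ 2 ] (N G (3 ℕ.+ Fin.toℕ k) ℕ.* H (3 ℕ.+ Fin.toℕ k)) ≡ ∑[ v < n ] H (degree G v)
  ∑-degree-classes H H0 H1 H2 = begin
    ∑[ k < r ] (N G (3 ℕ.+ Fin.toℕ k) ℕ.* H (3 ℕ.+ Fin.toℕ k))
      ≡⟨ sum-cong-≗ {r} (λ k → trans (cong (ℕ._* H (3 ℕ.+ Fin.toℕ k)) (N≡count G (3 ℕ.+ Fin.toℕ k)))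
                                  (*-distribʳ-sum (H (3 ℕ.+ Fin.toℕ k)) (λ v → [ degree G v ≡ᵇ 3 ℕ.+ Fin.toℕ k ]))) ⟩
    ∑[ k < r ] ∑[ v < n ] class k v
      ≡⟨ ∑-comm class ⟩
    ∑[ v < n ] ∑[ k < r ] class k v
      ≡⟨ sum-cong-≗ (λ v → ∑-class (degree G v) (degree≤maxDeg G v)) ⟩
    ∑[ v < n ] H (degree G v) ∎
    where
    open ≡-Reasoning
    r : ℕ
    r = maxDeg G ∸ 2
    class : Fin r → Fin n → ℕ
    class k v = [ degree G v ≡ᵇ 3 ℕ.+ Fin.toℕ k ] ℕ.* H (3 ℕ.+ Fin.toℕ k)
    ∑-class : ∀ x → x ≤ maxDeg G → ∑[ k < r ] ([ x ≡ᵇ 3 ℕ.+ Fin.toℕ k ] ℕ.* H (3 ℕ.+ Fin.toℕ k)) ≡ H x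
    ∑-class 0 _ = trans (sum-zeros r) (sym H0)
    ∑-class 1 _ = trans (sum-zeros r) (sym H1)
    ∑-class 2 _ = trans (sum-zeros r) (sym H2)
    ∑-class (suc (suc (suc e))) x≤Δ = ∑-δℕ (λ k → H (3 ℕ.+ k)) e (ℕP.∸-monoˡ-≤ 2 x≤Δ)

  sum3to-degree-classes : ∀ (H : ℕ → ℕ) → H 0 ≡ 0 → H 1 ≡ 0 → H 2 ≡ 0 → (F : ℕ → ℚ) → (∀ i → F i ≡ ℕ→ℚ (N G i ℕ.* H i)) →
    sum3to (maxDeg G) F ≡ ℕ→ℚ (∑[ v < n ] H (degree G v))
  sum3to-degree-classes H H0 H1 H2 F F≡ = begin
    sum3to (maxDeg G) F
      ≡⟨ sumℚ-map-applyUpTo (λ k → F (3 ℕ.+ k)) id (maxDeg G ∸ 2) ⟩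
    ℚΣ.sum {maxDeg G ∸ 2} (λ k → F (3 ℕ.+ Fin.toℕ k))
      ≡⟨ ℚΣ.sum-cong-≗ {maxDeg G ∸ 2} (λ k → F≡ (3 ℕ.+ Fin.toℕ k)) ⟩
    ℚΣ.sum {maxDeg G ∸ 2} (λ k → ℕ→ℚ (N G (3 ℕ.+ Fin.toℕ k) ℕ.* H (3 ℕ.+ Fin.toℕ k)))
      ≡⟨ sym (ℕ→ℚ-sum {maxDeg G ∸ 2} (λ k → N G (3 ℕ.+ Fin.toℕ k) ℕ.* H (3 ℕ.+ Fin.toℕ k))) ⟩
    ℕ→ℚ (∑[ k < maxDeg G ∸ 2 ] (N G (3 ℕ.+ Fin.toℕ k) ℕ.* H (3 ℕ.+ Fin.toℕ k)))
      ≡⟨ cong ℕ→ℚ (∑-degree-classes H H0 H1 H2) ⟩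
    ℕ→ℚ (∑[ v < n ] H (degree G v)) ∎
    where open ≡-Reasoning

-- The irregularity measures of a tree

module _ {m : ℕ} (G : Graph (2 ℕ.+ m)) (tree : IsTree G) where

  open DegreeSequence (degree G) (degree≥1-tree G tree) (degree-sum-tree G tree)
  open ≡-Reasoning

  private
    Δ : ℕ
    Δ = maxDeg G
    1/n : ℚ
    1/n = 1/suc (suc m)

  avgDeg-tree : avgDeg G ≡ ℕ→ℚ (2 ℕ.* suc m) * 1/n
  avgDeg-tree = cong (λ e → ℕ→ℚ e * 1/n) (begin
    2 ℕ.* edges G            ≡⟨ cong (edges G ℕ.+_) (ℕP.+-identityʳ (edges G)) ⟩
    edges G ℕ.+ edges G      ≡⟨ sym (handshake G) ⟩
    sum (degree G)           ≡⟨ degree-sum-tree G tree ⟩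
    suc m ℕ.+ suc m          ≡⟨ cong (suc m ℕ.+_) (sym (ℕP.+-identityʳ (suc m))) ⟩
    2 ℕ.* suc m              ∎)

  S-tree : S G ≡ divℕ (ℕ→ℚ (4 ℕ.* m)) (2 ℕ.+ m)
                 + divℕ (ℕ→ℚ (2 ℕ.* m)) (2 ℕ.+ m) * sum3to Δ (λ i → ℕ→ℚ (N G i) * ℕ→ℚ (i ∸ 2))
  S-tree = begin
    S G
      ≡⟨ sumℚ-map-tabulate (λ v → ∣ ℕ→ℚ (degree G v) - avgDeg G ∣) id ⟩
    ℚΣ.sum {2 ℕ.+ m} (λ v → ∣ ℕ→ℚ (degree G v) - avgDeg G ∣)
      ≡⟨ ℚΣ.sum-cong-≗ {2 ℕ.+ m} (λ v → trans (cong (λ a → ∣ ℕ→ℚ (degree G v) - a ∣) avgDeg-tree)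
                                              (∣ℕ→ℚ-over-suc∣ (suc m) (degree G v) (2 ℕ.* suc m))) ⟩
    ℚΣ.sum {2 ℕ.+ m} (λ v → (ℕ→ℚ (deviation (degree G v)) * 1/n))
      ≡⟨ sym (ℚΣ.*-distribʳ-sum 1/n (ℕ→ℚ ∘ deviation ∘ degree G)) ⟩
    ℚΣ.sum {2 ℕ.+ m} (λ v → ℕ→ℚ (deviation (degree G v))) * 1/n
      ≡⟨ cong (_* 1/n) (trans (sym (ℕ→ℚ-sum (deviation ∘ degree G))) (cong ℕ→ℚ ∑-deviation)) ⟩
    ℕ→ℚ (4 ℕ.* m ℕ.+ 2 ℕ.* m ℕ.* excess) * 1/n
      ≡⟨ cong (_* 1/n) (trans (ℕ→ℚ-+ (4 ℕ.* m) (2 ℕ.* m ℕ.* excess)) (cong (ℕ→ℚ (4 ℕ.* m) +_) (ℕ→ℚ-* (2 ℕ.* m) excess))) ⟩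
    (ℕ→ℚ (4 ℕ.* m) + ℕ→ℚ (2 ℕ.* m) * ℕ→ℚ excess) * 1/n
      ≡⟨ distrib (ℕ→ℚ (4 ℕ.* m)) (ℕ→ℚ (2 ℕ.* m)) (ℕ→ℚ excess) 1/n ⟩
    ℕ→ℚ (4 ℕ.* m) * 1/n + ℕ→ℚ (2 ℕ.* m) * 1/n * ℕ→ℚ excess
      ≡⟨ cong (λ s → ℕ→ℚ (4 ℕ.* m) * 1/n + ℕ→ℚ (2 ℕ.* m) * 1/n * s)
              (sym (sum3to-degree-classes G (_∸ 2) refl refl refl (λ i → ℕ→ℚ (N G i) * ℕ→ℚ (i ∸ 2))
                                          (λ i → sym (ℕ→ℚ-* (N G i) (i ∸ 2))))) ⟩
    ℕ→ℚ (4 ℕ.* m) * 1/n + ℕ→ℚ (2 ℕ.* m) * 1/n * sum3to Δ (λ i → ℕ→ℚ (N G i) * ℕ→ℚ (i ∸ 2)) ∎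
    where
    distrib : ∀ a b p r → (a + b * p) * r ≡ a * r + b * r * p
    distrib = solve 4 (λ a b p r → (a :+ b :* p) :* r := a :* r :+ b :* r :* p) refl

  Var-tree : Var G ≡ divℕ (ℕ→ℚ (2 ℕ.* m)) ((2 ℕ.+ m) ℕ.* (2 ℕ.+ m))
                     + divℕ (sum3to Δ (λ i → ℕ→ℚ (N G i) * ℕ→ℚ (i ∸ 1) * ℕ→ℚ (i ∸ 2))) (2 ℕ.+ m)
  Var-tree = begin
    Var G
      ≡⟨ cong (_* 1/n) (sumℚ-map-tabulate (λ v → (ℕ→ℚ (degree G v) - avgDeg G) * (ℕ→ℚ (degree G v) - avgDeg G)) id) ⟩
    ℚΣ.sum (λ v → (ℕ→ℚ (degree G v) - avgDeg G) * (ℕ→ℚ (degree G v) - avgDeg G)) * 1/n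
      ≡⟨ cong (_* 1/n) (ℚΣ.sum-cong-≗ {2 ℕ.+ m} (λ v →
           trans (cong (λ a → (ℕ→ℚ (degree G v) - a) * (ℕ→ℚ (degree G v) - a)) avgDeg-tree)
                 ([ℕ→ℚ-over-suc]² (suc m) (degree G v) (2 ℕ.* suc m)))) ⟩
    ℚΣ.sum (λ v → ℕ→ℚ (deviation (degree G v) ℕ.* deviation (degree G v)) * (1/n * 1/n)) * 1/n
      ≡⟨ cong (_* 1/n) (sym (ℚΣ.*-distribʳ-sum (1/n * 1/n) (λ v → ℕ→ℚ (deviation (degree G v) ℕ.* deviation (degree G v))))) ⟩
    ℚΣ.sum (λ v → ℕ→ℚ (deviation (degree G v) ℕ.* deviation (degree G v))) * (1/n * 1/n) * 1/n
      ≡⟨ cong (λ s → s * (1/n * 1/n) * 1/n)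
              (trans (sym (ℕ→ℚ-sum (λ v → deviation (degree G v) ℕ.* deviation (degree G v)))) (cong ℕ→ℚ ∑-deviation²)) ⟩
    ℕ→ℚ (2 ℕ.* m ℕ.* n ℕ.+ n ℕ.* n ℕ.* Q) * (1/n * 1/n) * 1/n
      ≡⟨ ℕ→ℚ-over-suc³ (suc m) (2 ℕ.* m) Q ⟩
    ℕ→ℚ (2 ℕ.* m) * (1/n * 1/n) + ℕ→ℚ Q * 1/n
      ≡⟨ cong₂ (λ r s → ℕ→ℚ (2 ℕ.* m) * r + s * 1/n) (sym (1/suc-* (suc m) (suc m) _ refl))
              (sym (sum3to-degree-classes G (λ i → (i ∸ 1) ℕ.* (i ∸ 2)) refl refl refl
                      (λ i → ℕ→ℚ (N G i) * ℕ→ℚ (i ∸ 1) * ℕ→ℚ (i ∸ 2)) (λ i → ℕ→ℚ-*-* (N G i) (i ∸ 1) (i ∸ 2)))) ⟩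
    divℕ (ℕ→ℚ (2 ℕ.* m)) (n ℕ.* n) + divℕ (sum3to Δ (λ i → ℕ→ℚ (N G i) * ℕ→ℚ (i ∸ 1) * ℕ→ℚ (i ∸ 2))) n ∎
    where
    n Q : ℕ
    n = 2 ℕ.+ m
    Q = ∑[ v < 2 ℕ.+ m ] ((degree G v ∸ 1) ℕ.* (degree G v ∸ 2))
    ℕ→ℚ-*-* : ∀ a b c → ℕ→ℚ a * ℕ→ℚ b * ℕ→ℚ c ≡ ℕ→ℚ (a ℕ.* (b ℕ.* c))
    ℕ→ℚ-*-* a b c = sym (trans (ℕ→ℚ-* a (b ℕ.* c)) (trans (cong (ℕ→ℚ a *_) (ℕ→ℚ-* b c)) (sym (ℚP.*-assoc (ℕ→ℚ a) (ℕ→ℚ b) (ℕ→ℚ c)))))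

  IRR-tree : IRR G ≡ divℕ (ℕ→ℚ (2 ℕ.+ m)) 2 * (ℕ→ℚ Δ - ℕ→ℚ 1)
  IRR-tree = cong (λ δ → divℕ (ℕ→ℚ (2 ℕ.+ m)) 2 * (ℕ→ℚ Δ - ℕ→ℚ δ)) (minDeg-tree G tree)

  private
    NΔ X : ℕ
    NΔ = count (λ v → degree G v ≡ᵇ Δ)
    X  = 2 ℕ.* NΔ ℕ.* (2 ℕ.+ excess) ℕ.* (Δ ∸ 1)

    N-Δ : N G Δ ≡ NΔ
    N-Δ = N≡count G Δ

    1≤Δ : 1 ≤ Δ
    1≤Δ = ℕP.≤-trans (degree≥1-tree G tree Fin.zero) (degree≤maxDeg G Fin.zero)

    1≤NΔ : 1 ≤ NΔ
    1≤NΔ with maxDeg-attained G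
    ... | v , deg≡Δ = subst (_≤ NΔ) (T⇒[]≡1 (ℕP.≡⇒≡ᵇ _ _ deg≡Δ)) (term≤sum (λ u → [ degree G u ≡ᵇ Δ ]) v)

  IRD-bound : ℚ
  IRD-bound = divℕ (ℕ→ℚ (4 ℕ.* N G Δ ℕ.* (Δ ∸ 1))
                    + ℕ→ℚ (2 ℕ.* N G Δ) * sum3to Δ (λ i → ℕ→ℚ (i ∸ 2) * ℕ→ℚ (N G i) * ℕ→ℚ (Δ ∸ 1)))
                   (2 ℕ.+ (Δ ∸ 1) ℕ.* N G Δ)

  IRD-tree : IRD G ≡ ℕ→ℚ X * 1/suc (suc (excess ℕ.+ NΔ))
  IRD-tree = begin
    IRD G
      ≡⟨ cong (λ δ → divℕ (ℕ→ℚ (2 ℕ.* N G Δ ℕ.* N G δ)) (N G δ ℕ.+ N G Δ) * (ℕ→ℚ Δ - ℕ→ℚ δ)) (minDeg-tree G tree) ⟩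
    divℕ (ℕ→ℚ (2 ℕ.* N G Δ ℕ.* N G 1)) (N G 1 ℕ.+ N G Δ) * (ℕ→ℚ Δ - ℕ→ℚ 1)
      ≡⟨ cong₂ (λ l k → divℕ (ℕ→ℚ (2 ℕ.* k ℕ.* l)) (l ℕ.+ k) * (ℕ→ℚ Δ - ℕ→ℚ 1))
               (trans (N≡count G 1) leaves≡2+excess) N-Δ ⟩
    ℕ→ℚ (2 ℕ.* NΔ ℕ.* (2 ℕ.+ excess)) * r * (ℕ→ℚ Δ - ℕ→ℚ 1)
      ≡⟨ cong (ℕ→ℚ (2 ℕ.* NΔ ℕ.* (2 ℕ.+ excess)) * r *_) (ℕ→ℚ-∸ 1≤Δ) ⟩
    ℕ→ℚ (2 ℕ.* NΔ ℕ.* (2 ℕ.+ excess)) * r * ℕ→ℚ (Δ ∸ 1)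
      ≡⟨ swap (ℕ→ℚ (2 ℕ.* NΔ ℕ.* (2 ℕ.+ excess))) r (ℕ→ℚ (Δ ∸ 1)) ⟩
    ℕ→ℚ (2 ℕ.* NΔ ℕ.* (2 ℕ.+ excess)) * ℕ→ℚ (Δ ∸ 1) * r
      ≡⟨ cong (_* r) (sym (ℕ→ℚ-* (2 ℕ.* NΔ ℕ.* (2 ℕ.+ excess)) (Δ ∸ 1))) ⟩
    ℕ→ℚ X * r ∎
    where
    r = 1/suc (suc (excess ℕ.+ NΔ))
    swap : ∀ a r b → a * r * b ≡ a * b * r
    swap = solve 3 (λ a r b → a :* r :* b := a :* b :* r) refl

  IRD-bound-tree : IRD-bound ≡ ℕ→ℚ X * 1/suc (suc ((Δ ∸ 1) ℕ.* NΔ))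
  IRD-bound-tree = begin
    IRD-bound
      ≡⟨ cong (λ k → divℕ (ℕ→ℚ (4 ℕ.* k ℕ.* (Δ ∸ 1)) + ℕ→ℚ (2 ℕ.* k) * s) (2 ℕ.+ (Δ ∸ 1) ℕ.* k)) N-Δ ⟩
    (ℕ→ℚ (4 ℕ.* NΔ ℕ.* (Δ ∸ 1)) + ℕ→ℚ (2 ℕ.* NΔ) * s) * r
      ≡⟨ cong (λ t → (ℕ→ℚ (4 ℕ.* NΔ ℕ.* (Δ ∸ 1)) + ℕ→ℚ (2 ℕ.* NΔ) * t) * r) s≡ ⟩
    (ℕ→ℚ (4 ℕ.* NΔ ℕ.* (Δ ∸ 1)) + ℕ→ℚ (2 ℕ.* NΔ) * ℕ→ℚ (excess ℕ.* (Δ ∸ 1))) * r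
      ≡⟨ cong (_* r) (sym (trans (ℕ→ℚ-+ (4 ℕ.* NΔ ℕ.* (Δ ∸ 1)) _) (cong (ℕ→ℚ (4 ℕ.* NΔ ℕ.* (Δ ∸ 1)) +_) (ℕ→ℚ-* (2 ℕ.* NΔ) _)))) ⟩
    ℕ→ℚ (4 ℕ.* NΔ ℕ.* (Δ ∸ 1) ℕ.+ 2 ℕ.* NΔ ℕ.* (excess ℕ.* (Δ ∸ 1))) * r
      ≡⟨ cong (λ k → ℕ→ℚ k * r) (arith NΔ excess (Δ ∸ 1)) ⟩
    ℕ→ℚ X * r ∎
    where
    r = 1/suc (suc ((Δ ∸ 1) ℕ.* NΔ))
    s = sum3to Δ (λ i → ℕ→ℚ (i ∸ 2) * ℕ→ℚ (N G i) * ℕ→ℚ (Δ ∸ 1))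
    s≡ : s ≡ ℕ→ℚ (excess ℕ.* (Δ ∸ 1))
    s≡ = trans (sum3to-degree-classes G (λ i → (i ∸ 2) ℕ.* (Δ ∸ 1)) refl refl refl _
                 (λ i → trans (rearrange (ℕ→ℚ (i ∸ 2)) (ℕ→ℚ (N G i)) (ℕ→ℚ (Δ ∸ 1)))
                              (sym (trans (ℕ→ℚ-* (N G i) _) (cong (ℕ→ℚ (N G i) *_) (ℕ→ℚ-* (i ∸ 2) (Δ ∸ 1)))))))
               (cong ℕ→ℚ (sym (*-distribʳ-sum (Δ ∸ 1) (λ v → degree G v ∸ 2))))
      where
      rearrange : ∀ a b c → a * b * c ≡ b * (a * c)
      rearrange = solve 3 (λ a b c → a :* b :* c := b :* (a :* c)) refl
    arith : ∀ k p e → 4 ℕ.* k ℕ.* e ℕ.+ 2 ℕ.* k ℕ.* (p ℕ.* e) ≡ 2 ℕ.* k ℕ.* (2 ℕ.+ p) ℕ.* e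
    arith = solve-∀

  private
    excess-gap : (Δ ∸ 1) ℕ.* NΔ ≤ excess ℕ.+ NΔ
    excess-gap = ℕP.≤-trans (ℕP.*-monoˡ-≤ NΔ (∸1≤suc∸2 Δ))
                   (ℕP.≤-trans (ℕP.+-monoʳ-≤ NΔ (excess≥ (degree G) Δ)) (ℕP.≤-reflexive (ℕP.+-comm NΔ excess)))
      where
      ∸1≤suc∸2 : ∀ x → x ∸ 1 ≤ suc (x ∸ 2)
      ∸1≤suc∸2 zero          = z≤n
      ∸1≤suc∸2 (suc zero)    = z≤n
      ∸1≤suc∸2 (suc (suc x)) = ℕP.≤-refl

  IRD≤bound : IRD G ≤ℚ IRD-bound
  IRD≤bound = subst₂ _≤ℚ_ (sym IRD-tree) (sym IRD-bound-tree)
    (ℚP.*-monoˡ-≤-nonNeg (ℕ→ℚ X) {{ℚ.nonNegative (ℕ→ℚ-nonNeg X)}} (1/suc-antimono-≤ (s≤s excess-gap)))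

  private
    Degrees⊆ : Set
    Degrees⊆ = ∀ v → degree G v ≡ 1 ⊎ degree G v ≡ 2 ⊎ degree G v ≡ Δ

    module _ (2≤Δ : 2 ≤ Δ) where

      Δ∸1≡ : Δ ∸ 1 ≡ suc (Δ ∸ 2)
      Δ∸1≡ = ℕP.+-∸-assoc 1 {Δ} {2} 2≤Δ

      1≤X : 1 ≤ X
      1≤X = ℕP.*-mono-≤ (ℕP.*-mono-≤ (ℕP.*-mono-≤ {1} {2} (s≤s z≤n) 1≤NΔ) (s≤s z≤n))
                        (ℕP.≤-trans (s≤s z≤n) (ℕP.≤-reflexive (sym Δ∸1≡)))

      tight⇒degrees : IRD G ≡ IRD-bound → Degrees⊆
      tight⇒degrees eq = excess≡⇒degrees (degree G) Δ (degree≥1-tree G tree) (sym excess≡)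
        where
        same-denominator : excess ℕ.+ NΔ ≡ (Δ ∸ 1) ℕ.* NΔ
        same-denominator = ℕP.suc-injective (1/suc-injective
          (ℕ→ℚ-*-cancelˡ 1≤X (trans (sym IRD-tree) (trans eq IRD-bound-tree))))
        excess≡ : excess ≡ (Δ ∸ 2) ℕ.* NΔ
        excess≡ = ℕP.+-cancelʳ-≡ NΔ excess ((Δ ∸ 2) ℕ.* NΔ)
          (trans same-denominator (trans (cong (ℕ._* NΔ) Δ∸1≡) (ℕP.+-comm NΔ ((Δ ∸ 2) ℕ.* NΔ))))

      degrees⇒tight : Degrees⊆ → IRD G ≡ IRD-bound
      degrees⇒tight degs = trans IRD-tree (trans (cong (λ k → ℕ→ℚ X * 1/suc (suc k)) same-denominator) (sym IRD-bound-tree))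
        where
        same-denominator : excess ℕ.+ NΔ ≡ (Δ ∸ 1) ℕ.* NΔ
        same-denominator = trans (cong (ℕ._+ NΔ) (sym (degrees⇒excess≡ (degree G) Δ degs)))
          (trans (ℕP.+-comm ((Δ ∸ 2) ℕ.* NΔ) NΔ) (cong (ℕ._* NΔ) (sym Δ∸1≡)))

    module _ (Δ≤1 : Δ ≤ 1) where

      all-leaves : Degrees⊆
      all-leaves v = inj₁ (ℕP.≤-antisym (ℕP.≤-trans (degree≤maxDeg G v) Δ≤1) (degree≥1-tree G tree v))

      always-tight : IRD G ≡ IRD-bound
      always-tight = begin
        IRD G                                            ≡⟨ IRD-tree ⟩
        ℕ→ℚ X * 1/suc (suc (excess ℕ.+ NΔ))              ≡⟨ cong (λ x → ℕ→ℚ x * 1/suc (suc (excess ℕ.+ NΔ))) X≡0 ⟩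
        0ℚ * 1/suc (suc (excess ℕ.+ NΔ))                 ≡⟨ ℚP.*-zeroˡ (1/suc (suc (excess ℕ.+ NΔ))) ⟩
        0ℚ                                               ≡⟨ sym (ℚP.*-zeroˡ (1/suc (suc ((Δ ∸ 1) ℕ.* NΔ)))) ⟩
        0ℚ * 1/suc (suc ((Δ ∸ 1) ℕ.* NΔ))                ≡⟨ cong (λ x → ℕ→ℚ x * 1/suc (suc ((Δ ∸ 1) ℕ.* NΔ))) (sym X≡0) ⟩
        ℕ→ℚ X * 1/suc (suc ((Δ ∸ 1) ℕ.* NΔ))             ≡⟨ sym IRD-bound-tree ⟩
        IRD-bound                                        ∎
        where
        X≡0 : X ≡ 0
        X≡0 = trans (cong (2 ℕ.* NΔ ℕ.* (2 ℕ.+ excess) ℕ.*_) (ℕP.m≤n⇒m∸n≡0 Δ≤1)) (ℕP.*-zeroʳ (2 ℕ.* NΔ ℕ.* (2 ℕ.+ excess)))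

  IRD≡bound⇔degrees : (IRD G ≡ IRD-bound) ⇔ (∀ v → degree G v ≡ 1 ⊎ degree G v ≡ 2 ⊎ degree G v ≡ Δ)
  IRD≡bound⇔degrees = by-cases (2 ℕ.≤? Δ)
    where
    by-cases : Dec (2 ≤ Δ) → (IRD G ≡ IRD-bound) ⇔ Degrees⊆
    by-cases (yes 2≤Δ) = mk⇔ (tight⇒degrees 2≤Δ) (degrees⇒tight 2≤Δ)
    by-cases (no Δ≱2)  = mk⇔ (λ _ → all-leaves Δ≤1) (λ _ → always-tight Δ≤1)
      where
      Δ≤1 : Δ ≤ 1
      Δ≤1 = ℕP.≤-pred (ℕP.≰⇒> Δ≱2)

theorem22 : (n : ℕ) → 2 ≤ n → (T : Graph n) → IsTree T →
    let Δ = maxDeg T in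
    (S T ≡ divℕ (ℕ→ℚ (4 ℕ.* (n ℕ.∸ 2))) n
           + divℕ (ℕ→ℚ (2 ℕ.* (n ℕ.∸ 2))) n * sum3to Δ (λ i → ℕ→ℚ (N T i) * ℕ→ℚ (i ℕ.∸ 2)))
    × (Var T ≡ divℕ (ℕ→ℚ (2 ℕ.* (n ℕ.∸ 2))) (n ℕ.* n)
           + divℕ (sum3to Δ (λ i → ℕ→ℚ (N T i) * ℕ→ℚ (i ℕ.∸ 1) * ℕ→ℚ (i ℕ.∸ 2))) n)
    × (IRR T ≡ divℕ (ℕ→ℚ n) 2 * (ℕ→ℚ Δ - ℕ→ℚ 1))
    × (IRD T ≤ℚ divℕ (ℕ→ℚ (4 ℕ.* N T Δ ℕ.* (Δ ℕ.∸ 1))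
                        + ℕ→ℚ (2 ℕ.* N T Δ) * sum3to Δ (λ i → ℕ→ℚ (i ℕ.∸ 2) * ℕ→ℚ (N T i) * ℕ→ℚ (Δ ℕ.∸ 1)))
                      (2 ℕ.+ (Δ ℕ.∸ 1) ℕ.* N T Δ))
    × ((IRD T ≡ divℕ (ℕ→ℚ (4 ℕ.* N T Δ ℕ.* (Δ ℕ.∸ 1))
                        + ℕ→ℚ (2 ℕ.* N T Δ) * sum3to Δ (λ i → ℕ→ℚ (i ℕ.∸ 2) * ℕ→ℚ (N T i) * ℕ→ℚ (Δ ℕ.∸ 1)))
                      (2 ℕ.+ (Δ ℕ.∸ 1) ℕ.* N T Δ))
       ⇔ (∀ v → degree T v ≡ 1 ⊎ degree T v ≡ 2 ⊎ degree T v ≡ Δ))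
theorem22 (suc (suc m)) (s≤s (s≤s z≤n)) T tree =
  S-tree T tree , Var-tree T tree , IRR-tree T tree , IRD≤bound T tree , IRD≡bound⇔degrees T tree
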